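{- For integers $a,b,n\ge0$: (1) $\mathcal{D}_{n+1}(x)=\sum_{k=0}^{\lfloor n/2\rfloor}\binom{n-k}{k}x^k(1+x)^{n-2k}$ and $D(a,b)=\sum_{k\ge0}\binom{a+b-k}{k}\binom{a+b-2k}{b-k}$. (2) $\mathcal{H}_{n+1}(x)=\sum_{k=0}^{\lfloor n/2\rfloor}\binom{n-k}{k}x^k(1+x)^{n-k}$ and $D'(a,b)=\sum_{k\ge0}\binom{k}{a+b-k}\binom{k}{a}$. (3) $\mathcal{I}_{n+1}(x)=\sum_{k=0}^{\lfloor n/3\rfloor}\binom{n-2k}{k}x^{n-2k}(1+x)^k$ and $D''(a,b)=\sum_{k\ge0}\binom{a+b-2k}{k}\binom{k}{a-k}$.
   Context: A lattice path with steps in $S\subseteq\mathbb{N}^2$ is a finite sequence of elements of $S$, viewed as a path starting at $(0,0)$. $D(a,b)$, $D'(a,b)$, $D''(a,b)$ denote the numbers of lattice paths ending at $(a,b)$ with steps in $\{(1,0),(1,1),(0,1)\}$, $\{(1,0),(1,1),(0,1),(0,2)\}$, and $\{(2,1),(1,2),(0,1)\}$ respectively. For $n\ge0$ define $\mathcal{D}_{n+1}(x)=\sum_{k=0}^nD(n-k,k)x^k$, $\mathcal{H}_{n+1}(x)=\sum_{k=0}^nD'(n-k,k)x^k$, $\mathcal{I}_{n+1}(x)=\sum_{k=0}^nD''(n-k,k)x^k$. Binomial coefficients $\binom{m}{k}$ are taken to be $0$ unless $0\le k\le m$. -}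

module Defs where

open import Data.Nat using (ℕ; zero; suc; _+_; _*_; _∸_; _≡ᵇ_)
open import Data.Nat.Combinatorics using (_C_)
open import Data.Integer using (ℤ; +_; -[1+_])
open import Data.Bool using (Bool; true; false; if_then_else_; _∧_)
open import Data.List using (List; []; _∷_; map; concatMap; replicate; _++_)
open import Data.Product using (_×_; _,_)
open import Relation.Binary.PropositionalEquality using (_≡_)

Σ< : (ℕ → ℕ) → ℕ → ℕ
Σ< f zero    = 0
Σ< f (suc n) = Σ< f n + f n

-- Binomial coefficient with integer arguments, equal to 0 unless 0 ≤ k ≤ m
-- (stdlib's  m C k  is already 0 when k > m).

binom : ℤ → ℤ → ℕ
binom (+ m)     (+ k)     = m C k
binom (+ m)     -[1+ _ ]  = 0
binom -[1+ _ ]  _         = 0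

-- Lattice paths.  A step set is a list of steps in ℕ²; a path is a list
-- of steps, starting at (0,0).

Step : Set
Step = ℕ × ℕ

endpoint : List Step → ℕ × ℕ
endpoint []             = 0 , 0
endpoint ((x , y) ∷ w) with endpoint w
... | (p , q) = x + p , y + q

words : List Step → ℕ → List (List Step)
words S zero    = [] ∷ []
words S (suc n) = concatMap (λ s → map (s ∷_) (words S n)) S

countᵇ : {A : Set} → (A → Bool) → List A → ℕ
countᵇ p []       = 0
countᵇ p (x ∷ xs) = (if p x then 1 else 0) + countᵇ p xs

endsAt : ℕ → ℕ → List Step → Bool
endsAt a b w with endpoint w
... | (p , q) = (p ≡ᵇ a) ∧ (q ≡ᵇ b)

-- Number of lattice paths with steps in S ending at (a,b), where every
-- step of S has coordinate sum ≥ 1 (true for the three step sets below),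
-- so such paths have length ≤ a + b.
numPaths : List Step → ℕ → ℕ → ℕ
numPaths S a b = Σ< (λ len → countᵇ (endsAt a b) (words S len)) (suc (a + b))

S-D S-D′ S-D″ : List Step
S-D  = (1 , 0) ∷ (1 , 1) ∷ (0 , 1) ∷ []
S-D′ = (1 , 0) ∷ (1 , 1) ∷ (0 , 1) ∷ (0 , 2) ∷ []
S-D″ = (2 , 1) ∷ (1 , 2) ∷ (0 , 1) ∷ []

D D′ D″ : ℕ → ℕ → ℕ
D  = numPaths S-D
D′ = numPaths S-D′
D″ = numPaths S-D″

-- Polynomials in x with ℕ coefficients, as coefficient lists
-- (constant term first); compared coefficientwise.

Poly : Set
Poly = List ℕ

coeff : Poly → ℕ → ℕ
coeff []       _       = 0
coeff (c ∷ p)  zero    = c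
coeff (c ∷ p)  (suc j) = coeff p j

_⊕_ : Poly → Poly → Poly
[]      ⊕ q       = q
(a ∷ p) ⊕ []      = a ∷ p
(a ∷ p) ⊕ (b ∷ q) = (a + b) ∷ (p ⊕ q)

_⊗_ : Poly → Poly → Poly
[]      ⊗ q = []
(a ∷ p) ⊗ q = map (a *_) q ⊕ (0 ∷ (p ⊗ q))

infixl 6 _⊕_
infixl 7 _⊗_

_≈P_ : Poly → Poly → Set
p ≈P q = ∀ j → coeff p j ≡ coeff q j

infix 4 _≈P_

const : ℕ → Poly
const c = c ∷ []

X 1+X : Poly
X   = 0 ∷ 1 ∷ []
1+X = 1 ∷ 1 ∷ []

_^P_ : Poly → ℕ → Poly
p ^P zero  = const 1
p ^P suc n = p ⊗ (p ^P n)

mono : ℕ → ℕ → Poly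
mono c k = replicate k 0 ++ (c ∷ [])

ΣP< : (ℕ → Poly) → ℕ → Poly
ΣP< f zero    = []
ΣP< f (suc n) = ΣP< f n ⊕ f n

-- The generating polynomials; calD n stands for 𝒟_{n+1}(x), etc.
--   𝒟_{n+1}(x) = Σ_{k=0}^{n} D(n-k,k) x^k

calD calH calI : ℕ → Poly
calD n = ΣP< (λ k → mono (D  (n ∸ k) k) k) (suc n)
calH n = ΣP< (λ k → mono (D′ (n ∸ k) k) k) (suc n)
calI n = ΣP< (λ k → mono (D″ (n ∸ k) k) k) (suc n)

-- Split the paths counted by D, D′, D″ according to their length L. For the three-step sets of D and D″
-- the length and the endpoint determine how many steps of each type a path uses, and the number of
-- paths of length L is the trinomial coefficient of these step counts; for D′ a step is (x , 1 − x + ε)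
-- with x, ε ∈ {0, 1} chosen independently, so there are C(L, a) C(L, a + b − L) paths. Both counts
-- follow by induction on L from the last-step recurrence, once one knows that a region of triples
-- (L, a, b) that misses (0, 0, 0) and is closed under stepping back contains no endpoint of a path.
-- Summing over L, reindexed by the number k of diagonal steps for D and of steps other than (0 , 1)
-- for D″, gives the closed forms; for D″ only the L with a + b − L even contribute. Since the
-- coefficient of x^j in c x^m (1 + x)^e is c C(e, j − m), the polynomial identities reduce termwise
-- to the closed forms at (n − j, j).
module Submission where

open import Defs
open import Data.Nat using (ℕ; _+_; _∸_; _*_; _/_)
open import Data.Integer using (+_) renaming (_+_ to _+ℤ_; _-_ to _-ℤ_; _*_ to _*ℤ_)
open import Data.Product using (_×_)
open import Data.Nat.Combinatorics using (_C_)
open import Relation.Binary.PropositionalEquality using (_≡_)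

open import Data.Nat using (zero; suc; _≡ᵇ_; _≤_; _<_; _≤?_; z≤n; s≤s; s≤s⁻¹; s<s⁻¹; NonZero)
open import Data.Nat.Properties
open import Data.Nat.DivMod using (_%_; m/n≡1+[m∸n]/n; [m+kn]%n≡m%n; m/n*n≤m; m*n/n≡m; /-monoˡ-≤; m/n≤m)
open import Data.Nat.Combinatorics using (nCk+nC[k+1]≡[n+1]C[k+1]; nCk≡nC[n∸k]; k>n⇒nCk≡0)
open import Data.Nat.Tactic.RingSolver using (solve-∀)
open import Data.Integer using (ℤ; -[1+_])
import Data.Integer.Properties as ℤ
import Data.Integer.Tactic.RingSolver as ℤ-Solver
open import Data.Bool using (Bool; false; if_then_else_; _∧_)
open import Data.Bool.Properties using (∧-zeroʳ)
open import Data.List using (List; []; _∷_; map; _++_; concatMap)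
open import Data.List.Relation.Unary.All using (All; []; _∷_)
open import Data.Product using (_,_; proj₁; proj₂)
open import Data.Sum using (_⊎_; inj₁; inj₂)
open import Data.Empty using (⊥-elim)
open import Relation.Binary.PropositionalEquality using (refl; sym; trans; cong; cong₂; subst; _≢_; ≢-sym; module ≡-Reasoning)
open import Relation.Nullary using (¬_; yes; no; contradiction)

Σ<-cong : ∀ {f g : ℕ → ℕ} n → (∀ k → k < n → f k ≡ g k) → Σ< f n ≡ Σ< g n
Σ<-cong zero    f≗g = refl
Σ<-cong (suc n) f≗g = cong₂ _+_ (Σ<-cong n (λ k k<n → f≗g k (m<n⇒m<1+n k<n))) (f≗g n ≤-refl)

Σ<-zero : ∀ {f : ℕ → ℕ} n → (∀ k → k < n → f k ≡ 0) → Σ< f n ≡ 0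
Σ<-zero zero    f≗0 = refl
Σ<-zero (suc n) f≗0 = cong₂ _+_ (Σ<-zero n (λ k k<n → f≗0 k (m<n⇒m<1+n k<n))) (f≗0 n ≤-refl)

Σ<-delta : ∀ {f : ℕ → ℕ} n j → (∀ k → k ≢ j → f k ≡ 0) → j < n → Σ< f n ≡ f j
Σ<-delta {f} (suc n) j f≗0 j<1+n with m≤n⇒m<n∨m≡n (s≤s⁻¹ j<1+n)
... | inj₁ j<n  = trans (cong₂ _+_ (Σ<-delta n j f≗0 j<n) (f≗0 n (≢-sym (<⇒≢ j<n)))) (+-identityʳ (f j))
... | inj₂ refl = cong (_+ f j) (Σ<-zero j (λ k k<j → f≗0 k (<⇒≢ k<j)))

Σ<-head : ∀ (f : ℕ → ℕ) n → Σ< f (suc n) ≡ f 0 + Σ< (λ k → f (suc k)) n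
Σ<-head f zero    = +-comm 0 (f 0)
Σ<-head f (suc n) = trans (cong (_+ f (suc n)) (Σ<-head f n)) (+-assoc (f 0) _ _)

Σ<-reverse : ∀ (f : ℕ → ℕ) n → Σ< f n ≡ Σ< (λ k → f (n ∸ suc k)) n
Σ<-reverse f zero    = refl
Σ<-reverse f (suc n) = begin
  Σ< f n + f n                           ≡⟨ cong (_+ f n) (Σ<-reverse f n) ⟩
  Σ< (λ k → f (n ∸ suc k)) n + f n       ≡⟨ +-comm _ (f n) ⟩
  f n + Σ< (λ k → f (n ∸ suc k)) n       ≡⟨ Σ<-head (λ k → f (suc n ∸ suc k)) n ⟨
  Σ< (λ k → f (suc n ∸ suc k)) (suc n)   ∎
  where open ≡-Reasoning

Σ<-truncate : ∀ {f : ℕ → ℕ} {m n} → m ≤ n → (∀ k → m ≤ k → k < n → f k ≡ 0) → Σ< f n ≡ Σ< f m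
Σ<-truncate {n = zero} z≤n _ = refl
Σ<-truncate {f} {m} {suc n} m≤1+n f≗0 with m≤n⇒m<n∨m≡n m≤1+n
... | inj₂ refl  = refl
... | inj₁ m<1+n = trans (cong₂ _+_ (Σ<-truncate m≤n f≗0′) (f≗0 n m≤n ≤-refl)) (+-identityʳ _)
  where
  m≤n : m ≤ n
  m≤n = s≤s⁻¹ m<1+n
  f≗0′ : ∀ k → m ≤ k → k < n → f k ≡ 0
  f≗0′ k m≤k k<n = f≗0 k m≤k (m<n⇒m<1+n k<n)

Σ<-same-parity : ∀ (f : ℕ → ℕ) N → (∀ L j → L + suc (2 * j) ≡ N → f L ≡ 0) →
                 Σ< f (suc N) ≡ Σ< (λ k → f (N ∸ 2 * k)) (N / 2 + 1)
Σ<-same-parity f zero          odd≗0 = refl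
Σ<-same-parity f (suc zero)    odd≗0 = cong (_+ f 1) (odd≗0 0 0 refl)
Σ<-same-parity f (suc (suc N)) odd≗0 = begin
  Σ< f (suc N) + f (suc N) + f (2 + N)
    ≡⟨ cong₂ (λ s t → s + t + f (2 + N)) (Σ<-same-parity f N odd≗0′) (odd≗0 (suc N) 0 (+-comm (suc N) 1)) ⟩
  Σ< g (N / 2 + 1) + 0 + f (2 + N)
    ≡⟨ trans (cong (_+ f (2 + N)) (+-identityʳ _)) (+-comm _ (f (2 + N))) ⟩
  f (2 + N) + Σ< g (N / 2 + 1)
    ≡⟨ cong (λ s → f (2 + N) + s) (Σ<-cong (N / 2 + 1) (λ k _ → cong (λ m → f (2 + N ∸ m)) (2*[1+k] k))) ⟨
  f (2 + N) + Σ< (λ k → f (2 + N ∸ 2 * suc k)) (N / 2 + 1)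
    ≡⟨ Σ<-head (λ k → f (2 + N ∸ 2 * k)) (N / 2 + 1) ⟨
  Σ< (λ k → f (2 + N ∸ 2 * k)) (suc (N / 2) + 1)
    ≡⟨ cong (λ m → Σ< (λ k → f (2 + N ∸ 2 * k)) (m + 1)) (m/n≡1+[m∸n]/n {2 + N} {2} (s≤s (s≤s z≤n))) ⟨
  Σ< (λ k → f (2 + N ∸ 2 * k)) ((2 + N) / 2 + 1) ∎
  where
  open ≡-Reasoning
  g : ℕ → ℕ
  g = λ k → f (N ∸ 2 * k)
  2*[1+k] : ∀ k → 2 * suc k ≡ 2 + 2 * k
  2*[1+k] = solve-∀
  odd≗0′ : ∀ L j → L + suc (2 * j) ≡ N → f L ≡ 0
  odd≗0′ L j eq = odd≗0 L (suc j) (trans (shift L j) (cong (λ m → 2 + m) eq))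
    where
    shift : ∀ L j → L + suc (2 * suc j) ≡ 2 + (L + suc (2 * j))
    shift = solve-∀

data Difference : ℕ → ℕ → Set where
  nonneg : ∀ k d → Difference (k + d) k
  neg    : ∀ n d → Difference n (n + suc d)

difference : ∀ n k → Difference n k
difference n       zero    = nonneg 0 n
difference zero    (suc k) = neg 0 k
difference (suc n) (suc k) with difference n k
... | nonneg k d = nonneg (suc k) d
... | neg n d    = neg (suc n) d

m+[1+d]≡n⇒m<n : ∀ {m n} d → m + suc d ≡ n → m < n
m+[1+d]≡n⇒m<n {m} d refl = m<m+n m (s≤s z≤n)

m<n+1⇒m≤n : ∀ {m n} → m < n + 1 → m ≤ n
m<n+1⇒m≤n {m} {n} m<n+1 = m<1+n⇒m≤n (subst (m <_) (+-comm n 1) m<n+1)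

m+1≤n⇒m<n : ∀ {m n} → m + 1 ≤ n → m < n
m+1≤n⇒m<n {m} {n} m+1≤n = subst (_≤ n) (+-comm m 1) m+1≤n

<-unshift : ∀ {m n m′ n′} δ ε → m′ < n′ → m + δ ≡ m′ → n + ε ≡ n′ → ε ≤ δ → m < n
<-unshift {m} {n} δ ε m′<n′ refl refl ε≤δ = +-cancelʳ-< δ m n (<-≤-trans m′<n′ (+-monoʳ-≤ n ε≤δ))

odd-unshift : ∀ {n n′} k → n′ % 2 ≡ 1 → n + k * 2 ≡ n′ → n % 2 ≡ 1
odd-unshift {n} k odd refl = trans (sym ([m+kn]%n≡m%n n k 2)) odd

positive-of-< : ∀ {n} c k → n < c * k → 0 < k
positive-of-< {n} c zero n<c*0 = contradiction (subst (n <_) (*-zeroʳ c) n<c*0) λ ()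
positive-of-< c (suc k) _       = s≤s z≤n

k≤n/d⇒d*k≤n : ∀ n d k .{{_ : NonZero d}} → k ≤ n / d → d * k ≤ n
k≤n/d⇒d*k≤n n d k k≤n/d = ≤-trans (≤-reflexive (*-comm d k)) (≤-trans (*-monoˡ-≤ d k≤n/d) (m/n*n≤m n d))

n/d<k⇒n<d*k : ∀ n d k .{{_ : NonZero d}} → n / d < k → n < d * k
n/d<k⇒n<d*k n d k n/d<k = ≰⇒> λ d*k≤n → <⇒≱ n/d<k (begin
  k            ≡⟨ m*n/n≡m k d ⟨
  k * d / d    ≤⟨ /-monoˡ-≤ d (subst (_≤ n) (*-comm d k) d*k≤n) ⟩
  n / d        ∎)
  where open ≤-Reasoning

atPred : (ℕ → ℕ) → ℕ → ℕ
atPred g zero    = 0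
atPred g (suc n) = g n

C-suc : ∀ n k → suc n C k ≡ atPred (n C_) k + n C k
C-suc n zero    = refl
C-suc n (suc k) = sym (nCk+nC[k+1]≡[n+1]C[k+1] n k)

C-sym : ∀ m n → (m + n) C m ≡ (m + n) C n
C-sym m n = trans (nCk≡nC[n∸k] (m≤m+n m n)) (cong ((m + n) C_) (m+n∸m≡n m n))

pos-minus-nonneg : ∀ k d → + (k + d) -ℤ + k ≡ + d
pos-minus-nonneg k d = trans (ℤ.[+m]-[+n]≡m⊖n (k + d) k) (trans (ℤ.⊖-≥ (m≤m+n k d)) (cong +_ (m+n∸m≡n k d)))

pos-minus-neg : ∀ n d → + n -ℤ + (n + suc d) ≡ -[1+ d ]
pos-minus-neg n d = trans (ℤ.[+m]-[+n]≡m⊖n n (n + suc d))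
  (trans (ℤ.⊖-< (m<m+n n (s≤s z≤n))) (cong (λ m → Data.Integer.- (+ m)) (m+n∸m≡n n (suc d))))

pos-minus : ∀ {n} k d → n ≡ k + d → + n -ℤ + k ≡ + d
pos-minus k d refl = pos-minus-nonneg k d

pos-two-times : ∀ k → + 2 *ℤ + k ≡ + (2 * k)
pos-two-times k = sym (ℤ.pos-* 2 k)

pos-minus-swap : ∀ {i j k l} → i + j ≡ k + l → + l -ℤ + i ≡ + j -ℤ + k
pos-minus-swap {i} {j} {k} {l} e = begin
  + l -ℤ + i                    ≡⟨ cancel (+ i) (+ k) (+ l) ⟩
  ((+ k +ℤ + l) -ℤ + k) -ℤ + i   ≡⟨ cong (λ x → (x -ℤ + k) -ℤ + i) (cong +_ e) ⟨
  ((+ i +ℤ + j) -ℤ + k) -ℤ + i   ≡⟨ regroup (+ i) (+ j) (+ k) ⟩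
  + j -ℤ + k                    ∎
  where
  open ≡-Reasoning
  cancel : ∀ (i k l : ℤ) → l -ℤ i ≡ ((k +ℤ l) -ℤ k) -ℤ i
  cancel = ℤ-Solver.solve-∀
  regroup : ∀ (i j k : ℤ) → ((i +ℤ j) -ℤ k) -ℤ i ≡ j -ℤ k
  regroup = ℤ-Solver.solve-∀

binom-neg : ∀ x d → binom x -[1+ d ] ≡ 0
binom-neg (+ n)    d = refl
binom-neg -[1+ n ] d = refl

binom-sym : ∀ n x → binom (+ n) x ≡ binom (+ n) (+ n -ℤ x)
binom-sym n -[1+ d ] = sym (k>n⇒nCk≡0 (m<m+n n (s≤s z≤n)))
binom-sym n (+ r) with difference n r
... | nonneg r d = trans (C-sym r d) (cong (binom (+ (r + d))) (sym (pos-minus-nonneg r d)))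
... | neg n d    = trans (k>n⇒nCk≡0 (m<m+n n (s≤s z≤n))) (sym (cong (binom (+ n)) (pos-minus-neg n d)))

binom-minus : ∀ n m r → 0 < r → binom (+ n -ℤ + m) (+ r) ≡ (n ∸ m) C r
binom-minus n m r 0<r with difference n m
... | nonneg m d = trans (cong (λ x → binom x (+ r)) (pos-minus-nonneg m d)) (cong (_C r) (sym (m+n∸m≡n m d)))
... | neg n d    = trans (cong (λ x → binom x (+ r)) (pos-minus-neg n d))
                         (sym (trans (cong (_C r) (m≤n⇒m∸n≡0 (m≤m+n n (suc d)))) (k>n⇒nCk≡0 0<r)))

binom-minus-vanish : ∀ n m r → n < m + r → binom (+ n -ℤ + m) (+ r) ≡ 0
binom-minus-vanish n m r n<m+r with difference n m
... | nonneg m d = trans (cong (λ x → binom x (+ r)) (pos-minus-nonneg m d)) (k>n⇒nCk≡0 (+-cancelˡ-< m d r n<m+r))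
... | neg n d    = cong (λ x → binom x (+ r)) (pos-minus-neg n d)

C-minus-vanish : ∀ n m r → n < m + r → 0 < r → (n ∸ m) C r ≡ 0
C-minus-vanish n m r n<m+r 0<r = trans (sym (binom-minus n m r 0<r)) (binom-minus-vanish n m r n<m+r)

<-double : ∀ {n} k → n < 2 * k → n < k + k
<-double {n} k = subst (n <_) (cong (λ m → k + m) (+-identityʳ k))

C-diagonal-vanish : ∀ n k → n < 2 * k → (n ∸ k) C k ≡ 0
C-diagonal-vanish n k n<2k = C-minus-vanish n k k (<-double k n<2k) (positive-of-< 2 k n<2k)

countᵇ-++ : ∀ {A : Set} (p : A → Bool) xs ys → countᵇ p (xs ++ ys) ≡ countᵇ p xs + countᵇ p ys
countᵇ-++ p []       ys = refl
countᵇ-++ p (x ∷ xs) ys = trans (cong (λ n → _ + n) (countᵇ-++ p xs ys)) (sym (+-assoc (if p x then 1 else 0) _ _))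

countᵇ-map : ∀ {A B : Set} (p : B → Bool) (f : A → B) xs → countᵇ p (map f xs) ≡ countᵇ (λ x → p (f x)) xs
countᵇ-map p f []       = refl
countᵇ-map p f (x ∷ xs) = cong (λ n → _ + n) (countᵇ-map p f xs)

countᵇ-cong : ∀ {A : Set} {p q : A → Bool} → (∀ x → p x ≡ q x) → ∀ xs → countᵇ p xs ≡ countᵇ q xs
countᵇ-cong p≗q []       = refl
countᵇ-cong p≗q (x ∷ xs) = cong₂ (λ b n → (if b then 1 else 0) + n) (p≗q x) (countᵇ-cong p≗q xs)

countᵇ-false : ∀ {A : Set} (xs : List A) → countᵇ (λ _ → false) xs ≡ 0
countᵇ-false []       = refl
countᵇ-false (x ∷ xs) = countᵇ-false xs

paths : List Step → ℕ → ℕ → ℕ → ℕ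
paths S L a b = countᵇ (endsAt a b) (words S L)

-- F (a - x) (b - y), read as 0 when (x, y) does not lie below (a, b)
back : ℕ → ℕ → (ℕ → ℕ → ℕ) → ℕ → ℕ → ℕ
back zero    zero    F a       b       = F a b
back zero    (suc y) F a       zero    = 0
back zero    (suc y) F a       (suc b) = back zero y F a b
back (suc x) y       F zero    b       = 0
back (suc x) y       F (suc a) b       = back x y F a b

back-+ : ∀ x y F a b → back x y F (x + a) (y + b) ≡ F a b
back-+ zero    zero    F a b = refl
back-+ zero    (suc y) F a b = back-+ zero y F a b
back-+ (suc x) y       F a b = back-+ x y F a b

back-vanish : ∀ x y F a b → (∀ a′ b′ → a ≡ x + a′ → b ≡ y + b′ → F a′ b′ ≡ 0) → back x y F a b ≡ 0
back-vanish zero    zero    F a       b       F≡0 = F≡0 a b refl refl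
back-vanish zero    (suc y) F a       zero    F≡0 = refl
back-vanish zero    (suc y) F a       (suc b) F≡0 = back-vanish zero y F a b (λ a′ b′ ea eb → F≡0 a′ b′ ea (cong suc eb))
back-vanish (suc x) y       F zero    b       F≡0 = refl
back-vanish (suc x) y       F (suc a) b       F≡0 = back-vanish x y F a b (λ a′ b′ ea eb → F≡0 a′ b′ (cong suc ea) eb)

endsAt-endpoint : ∀ a b w → endsAt a b w ≡ (proj₁ (endpoint w) ≡ᵇ a) ∧ (proj₂ (endpoint w) ≡ᵇ b)
endsAt-endpoint a b w with endpoint w
... | p , q = refl

endsAt-∷ : ∀ x y a b w → endsAt a b ((x , y) ∷ w) ≡ (x + proj₁ (endpoint w) ≡ᵇ a) ∧ (y + proj₂ (endpoint w) ≡ᵇ b)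
endsAt-∷ x y a b w with endpoint w
... | p , q = refl

countᵇ-back : ∀ x y a b (W : List (List Step)) →
  countᵇ (λ w → (x + proj₁ (endpoint w) ≡ᵇ a) ∧ (y + proj₂ (endpoint w) ≡ᵇ b)) W
    ≡ back x y (λ a′ b′ → countᵇ (endsAt a′ b′) W) a b
countᵇ-back zero    zero    a       b       W = countᵇ-cong (λ w → sym (endsAt-endpoint a b w)) W
countᵇ-back zero    (suc y) a       zero    W = trans (countᵇ-cong (λ w → ∧-zeroʳ _) W) (countᵇ-false W)
countᵇ-back zero    (suc y) a       (suc b) W = countᵇ-back zero y a b W
countᵇ-back (suc x) y       zero    b       W = countᵇ-false W
countᵇ-back (suc x) y       (suc a) b       W = countᵇ-back x y a b W

sumSteps : List Step → (ℕ → ℕ → ℕ) → ℕ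
sumSteps []            g = 0
sumSteps ((x , y) ∷ S) g = g x y + sumSteps S g

paths-suc : ∀ S L a b → paths S (suc L) a b ≡ sumSteps S (λ x y → back x y (paths S L) a b)
paths-suc S L a b = go S
  where
  W : List (List Step)
  W = words S L
  go : ∀ T → countᵇ (endsAt a b) (concatMap (λ s → map (s ∷_) W) T) ≡ sumSteps T (λ x y → back x y (paths S L) a b)
  go []            = refl
  go ((x , y) ∷ T) = trans (countᵇ-++ (endsAt a b) (map ((x , y) ∷_) W) _) (cong₂ _+_ (begin
    countᵇ (endsAt a b) (map ((x , y) ∷_) W)                                       ≡⟨ countᵇ-map (endsAt a b) ((x , y) ∷_) W ⟩
    countᵇ (λ w → endsAt a b ((x , y) ∷ w)) W                                      ≡⟨ countᵇ-cong (endsAt-∷ x y a b) W ⟩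
    countᵇ (λ w → (x + proj₁ (endpoint w) ≡ᵇ a) ∧ (y + proj₂ (endpoint w) ≡ᵇ b)) W ≡⟨ countᵇ-back x y a b W ⟩
    back x y (paths S L) a b                                                       ∎) (go T))
    where open ≡-Reasoning

BackClosed : List Step → (ℕ → ℕ → ℕ → Set) → Set
BackClosed S Z = All (λ s → ∀ {L a b} → Z (suc L) (proj₁ s + a) (proj₂ s + b) → Z L a b) S

paths-vanish : ∀ S (Z : ℕ → ℕ → ℕ → Set) → ¬ Z 0 0 0 → BackClosed S Z → ∀ L a b → Z L a b → paths S L a b ≡ 0
paths-vanish S Z ¬Z000 closed zero    zero    zero    z = ⊥-elim (¬Z000 z)
paths-vanish S Z ¬Z000 closed zero    zero    (suc b) z = refl
paths-vanish S Z ¬Z000 closed zero    (suc a) b       z = refl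
paths-vanish S Z ¬Z000 closed (suc L) a       b       z = trans (paths-suc S L a b) (go S closed)
  where
  go : ∀ T → BackClosed T Z → sumSteps T (λ x y → back x y (paths S L) a b) ≡ 0
  go []            []         = refl
  go ((x , y) ∷ T) (cl ∷ cls) = cong₂ _+_
    (back-vanish x y (paths S L) a b (λ { a′ b′ refl refl → paths-vanish S Z ¬Z000 closed L a′ b′ (cl z) }))
    (go T cls)

trinomial : ℕ → ℕ → ℕ → ℕ
trinomial p q r = ((p + q + r) C (p + q)) * ((p + q) C p)

trinomial-rec : ∀ {L} p q r → p + q + r ≡ suc L →
  trinomial p q r ≡ atPred (λ p′ → trinomial p′ q r) p + atPred (λ q′ → trinomial p q′ r) q + atPred (trinomial p q) r
trinomial-rec {L} p q r eq = begin
  trinomial p q r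
    ≡⟨ cong (λ n → (n C (p + q)) * ((p + q) C p)) eq ⟩
  (suc L C (p + q)) * ((p + q) C p)
    ≡⟨ cong (_* ((p + q) C p)) (C-suc L (p + q)) ⟩
  (atPred (L C_) (p + q) + L C (p + q)) * ((p + q) C p)
    ≡⟨ *-distribʳ-+ ((p + q) C p) (atPred (L C_) (p + q)) _ ⟩
  atPred (L C_) (p + q) * ((p + q) C p) + (L C (p + q)) * ((p + q) C p)
    ≡⟨ cong₂ _+_ (split-pq p q eq) (split-r r eq) ⟩
  atPred (λ p′ → trinomial p′ q r) p + atPred (λ q′ → trinomial p q′ r) q + atPred (trinomial p q) r ∎
  where
  open ≡-Reasoning
  split-r : ∀ r → p + q + r ≡ suc L → (L C (p + q)) * ((p + q) C p) ≡ atPred (trinomial p q) r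
  split-r zero    e = cong (_* ((p + q) C p)) (k>n⇒nCk≡0 (≤-reflexive (sym (trans (sym (+-identityʳ _)) e))))
  split-r (suc r) e = cong (λ n → (n C (p + q)) * ((p + q) C p)) (suc-injective (trans (sym e) (+-suc (p + q) r)))
  split-pq : ∀ p q → p + q + r ≡ suc L →
    atPred (L C_) (p + q) * ((p + q) C p) ≡ atPred (λ p′ → trinomial p′ q r) p + atPred (λ q′ → trinomial p q′ r) q
  split-pq zero    zero    e = refl
  split-pq zero    (suc q) e = cong (λ n → (n C q) * 1) (sym (suc-injective e))
  split-pq (suc p) q       e = begin
    (L C (p + q)) * (suc (p + q) C suc p)
      ≡⟨ cong ((L C (p + q)) *_) (C-suc (p + q) (suc p)) ⟩
    (L C (p + q)) * ((p + q) C p + (p + q) C suc p)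
      ≡⟨ *-distribˡ-+ (L C (p + q)) ((p + q) C p) _ ⟩
    (L C (p + q)) * ((p + q) C p) + (L C (p + q)) * ((p + q) C suc p)
      ≡⟨ cong₂ _+_ (cong (λ n → (n C (p + q)) * ((p + q) C p)) (sym (suc-injective e))) (by-q q (suc-injective e)) ⟩
    trinomial p q r + atPred (λ q′ → trinomial (suc p) q′ r) q ∎
    where
    by-q : ∀ q → p + q + r ≡ L → (L C (p + q)) * ((p + q) C suc p) ≡ atPred (λ q′ → trinomial (suc p) q′ r) q
    by-q zero    e′ = trans (cong ((L C (p + 0)) *_) (k>n⇒nCk≡0 (s≤s (≤-reflexive (+-identityʳ p))))) (*-zeroʳ (L C (p + 0)))
    by-q (suc q) e′ = cong₂ (λ n m → (n C m) * (m C suc p)) (trans (sym e′) (cong (_+ r) (+-suc p q))) (+-suc p q)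

back-atPred : ∀ x y F (E₁ E₂ T : ℕ → ℕ) c →
  (∀ c′ → E₁ (suc c′) ≡ x + E₁ c′) → (∀ c′ → E₂ (suc c′) ≡ y + E₂ c′) →
  (c ≡ 0 → ∀ a b → E₁ 0 ≡ x + a → E₂ 0 ≡ y + b → F a b ≡ 0) →
  (∀ c′ → c ≡ suc c′ → F (E₁ c′) (E₂ c′) ≡ T c′) →
  back x y F (E₁ c) (E₂ c) ≡ atPred T c
back-atPred x y F E₁ E₂ T zero    shift₁ shift₂ none previous = back-vanish x y F _ _ (none refl)
back-atPred x y F E₁ E₂ T (suc c) shift₁ shift₂ none previous =
  trans (cong₂ (back x y F) (shift₁ c) (shift₂ c)) (trans (back-+ x y F _ _) (previous c refl))

-- f L a b counts paths of length L to (a, b) with steps (u₁ , u₂), (v₁ , v₂), (w₁ , w₂); the last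
-- three hypotheses say that f vanishes one step of an unused type before (end₁ p q r , end₂ p q r).
module TrinomialCount (f : ℕ → ℕ → ℕ → ℕ) (u₁ u₂ v₁ v₂ w₁ w₂ : ℕ) where

  end₁ end₂ : ℕ → ℕ → ℕ → ℕ
  end₁ p q r = p * u₁ + q * v₁ + r * w₁
  end₂ p q r = p * u₂ + q * v₂ + r * w₂

  trinomial-count :
    f 0 0 0 ≡ 1 →
    (∀ L a b → f (suc L) a b ≡ back u₁ u₂ (f L) a b + back v₁ v₂ (f L) a b + back w₁ w₂ (f L) a b) →
    (∀ L q r a b → q + r ≡ suc L → end₁ 0 q r ≡ u₁ + a → end₂ 0 q r ≡ u₂ + b → f L a b ≡ 0) →
    (∀ L p r a b → p + 0 + r ≡ suc L → end₁ p 0 r ≡ v₁ + a → end₂ p 0 r ≡ v₂ + b → f L a b ≡ 0) →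
    (∀ L p q a b → p + q + 0 ≡ suc L → end₁ p q 0 ≡ w₁ + a → end₂ p q 0 ≡ w₂ + b → f L a b ≡ 0) →
    ∀ p q r → f (p + q + r) (end₁ p q r) (end₂ p q r) ≡ trinomial p q r
  trinomial-count base rec no-u no-v no-w p q r = go (p + q + r) p q r refl
    where
    shift-p : ∀ p q r x y z → suc p * x + q * y + r * z ≡ x + (p * x + q * y + r * z)
    shift-p = solve-∀
    shift-q : ∀ p q r x y z → p * x + suc q * y + r * z ≡ y + (p * x + q * y + r * z)
    shift-q = solve-∀
    shift-r : ∀ p q r x y z → p * x + q * y + suc r * z ≡ z + (p * x + q * y + r * z)
    shift-r = solve-∀
    go : ∀ L p q r → p + q + r ≡ L → f L (end₁ p q r) (end₂ p q r) ≡ trinomial p q r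
    go zero    zero    zero    zero    refl = base
    go (suc L) p       q       r       eq   = begin
      f (suc L) (end₁ p q r) (end₂ p q r)
        ≡⟨ rec L _ _ ⟩
      back u₁ u₂ F (end₁ p q r) (end₂ p q r) + back v₁ v₂ F (end₁ p q r) (end₂ p q r) + back w₁ w₂ F (end₁ p q r) (end₂ p q r)
        ≡⟨ cong₂ _+_ (cong₂ _+_ u-step v-step) w-step ⟩
      atPred (λ p′ → trinomial p′ q r) p + atPred (λ q′ → trinomial p q′ r) q + atPred (trinomial p q) r
        ≡⟨ trinomial-rec p q r eq ⟨
      trinomial p q r ∎
      where
      open ≡-Reasoning
      F : ℕ → ℕ → ℕ
      F = f L
      u-step : back u₁ u₂ F (end₁ p q r) (end₂ p q r) ≡ atPred (λ p′ → trinomial p′ q r) p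
      u-step = back-atPred u₁ u₂ F (λ p → end₁ p q r) (λ p → end₂ p q r) (λ p → trinomial p q r) p
        (λ p → shift-p p q r u₁ v₁ w₁) (λ p → shift-p p q r u₂ v₂ w₂)
        (λ { refl a b → no-u L q r a b eq }) (λ { p′ refl → go L p′ q r (suc-injective eq) })
      v-step : back v₁ v₂ F (end₁ p q r) (end₂ p q r) ≡ atPred (λ q′ → trinomial p q′ r) q
      v-step = back-atPred v₁ v₂ F (λ q → end₁ p q r) (λ q → end₂ p q r) (λ q → trinomial p q r) q
        (λ q → shift-q p q r u₁ v₁ w₁) (λ q → shift-q p q r u₂ v₂ w₂)
        (λ { refl a b → no-v L p r a b eq }) (λ { q′ refl → go L p q′ r (suc-injective (trans (cong (_+ r) (sym (+-suc p q′))) eq)) })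
      w-step : back w₁ w₂ F (end₁ p q r) (end₂ p q r) ≡ atPred (trinomial p q) r
      w-step = back-atPred w₁ w₂ F (end₁ p q) (end₂ p q) (trinomial p q) r
        (λ r → shift-r p q r u₁ v₁ w₁) (λ r → shift-r p q r u₂ v₂ w₂)
        (λ { refl a b → no-w L p q a b eq }) (λ { r′ refl → go L p q r′ (suc-injective (trans (sym (+-suc (p + q) r′)) eq)) })


Unreachable-D : ℕ → ℕ → ℕ → Set
Unreachable-D L a b = L < a ⊎ L < b ⊎ a + b < L

backClosed-D : BackClosed S-D Unreachable-D
backClosed-D = step-10 ∷ step-11 ∷ step-01 ∷ []
  where
  step-10 : ∀ {L a b} → Unreachable-D (suc L) (1 + a) b → Unreachable-D L a b
  step-10 (inj₁ L<a)         = inj₁ (s<s⁻¹ L<a)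
  step-10 (inj₂ (inj₁ L<b))  = inj₂ (inj₁ (<-trans (n<1+n _) L<b))
  step-10 (inj₂ (inj₂ a+b<L)) = inj₂ (inj₂ (s<s⁻¹ a+b<L))
  step-11 : ∀ {L a b} → Unreachable-D (suc L) (1 + a) (1 + b) → Unreachable-D L a b
  step-11 (inj₁ L<a)         = inj₁ (s<s⁻¹ L<a)
  step-11 (inj₂ (inj₁ L<b))  = inj₂ (inj₁ (s<s⁻¹ L<b))
  step-11 {a = a} (inj₂ (inj₂ a+b<L)) = inj₂ (inj₂ (≤-<-trans (+-monoʳ-≤ a (n≤1+n _)) (s<s⁻¹ a+b<L)))
  step-01 : ∀ {L a b} → Unreachable-D (suc L) a (1 + b) → Unreachable-D L a b
  step-01 (inj₁ L<a)         = inj₁ (<-trans (n<1+n _) L<a)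
  step-01 (inj₂ (inj₁ L<b))  = inj₂ (inj₁ (s<s⁻¹ L<b))
  step-01 {L} {a} {b} (inj₂ (inj₂ a+b<L)) = inj₂ (inj₂ (s<s⁻¹ (subst (_< suc L) (+-suc a b) a+b<L)))

paths-D-unreachable : ∀ L a b → Unreachable-D L a b → paths S-D L a b ≡ 0
paths-D-unreachable = paths-vanish S-D Unreachable-D (λ { (inj₁ ()) ; (inj₂ (inj₁ ())) ; (inj₂ (inj₂ ())) }) backClosed-D

open TrinomialCount (paths S-D) 0 1 1 0 1 1 using () renaming (trinomial-count to paths-D-count)

-- m steps (0 , 1), i steps (1 , 0) and k steps (1 , 1)
paths-D-trinomial : ∀ m i k → paths S-D (m + i + k) (k + i) (k + m) ≡ trinomial m i k
paths-D-trinomial m i k = trans (cong₂ (paths S-D (m + i + k)) (end₁ m i k) (end₂ m i k)) (paths-D-count refl rec no-01 no-10 no-11 m i k)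
  where
  end₁ : ∀ m i k → k + i ≡ m * 0 + i * 1 + k * 1
  end₁ = solve-∀
  end₂ : ∀ m i k → k + m ≡ m * 1 + i * 0 + k * 1
  end₂ = solve-∀
  rec : ∀ L a b → paths S-D (suc L) a b ≡ back 0 1 (paths S-D L) a b + back 1 0 (paths S-D L) a b + back 1 1 (paths S-D L) a b
  rec L a b = trans (paths-suc S-D L a b) (reorder (back 1 0 (paths S-D L) a b) (back 1 1 (paths S-D L) a b) (back 0 1 (paths S-D L) a b))
    where
    reorder : ∀ x y z → x + (y + (z + 0)) ≡ z + x + y
    reorder = solve-∀
  no-01 : ∀ L i k a b → i + k ≡ suc L → i * 1 + k * 1 ≡ a → i * 0 + k * 1 ≡ 1 + b → paths S-D L a b ≡ 0
  no-01 L i k a b e ea eb = paths-D-unreachable L a b (inj₁ (≤-reflexive (trans (sym e) (trans (ones i k) ea))))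
    where
    ones : ∀ i k → i + k ≡ i * 1 + k * 1
    ones = solve-∀
  no-10 : ∀ L m k a b → m + 0 + k ≡ suc L → m * 0 + 0 * 1 + k * 1 ≡ 1 + a → m * 1 + 0 * 0 + k * 1 ≡ b → paths S-D L a b ≡ 0
  no-10 L m k a b e ea eb = paths-D-unreachable L a b (inj₂ (inj₁ (≤-reflexive (trans (sym e) (trans (ones m k) eb)))))
    where
    ones : ∀ m k → m + 0 + k ≡ m * 1 + 0 * 0 + k * 1
    ones = solve-∀
  no-11 : ∀ L m i a b → m + i + 0 ≡ suc L → m * 0 + i * 1 + 0 * 1 ≡ 1 + a → m * 1 + i * 0 + 0 * 1 ≡ 1 + b → paths S-D L a b ≡ 0
  no-11 L m i a b e ea eb = paths-D-unreachable L a b (inj₂ (inj₂ (≤-reflexive (trans (sym (+-suc a b)) (suc-injective (begin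
      (1 + a) + (1 + b)                                          ≡⟨ cong₂ _+_ ea eb ⟨
      (m * 0 + i * 1 + 0 * 1) + (m * 1 + i * 0 + 0 * 1)          ≡⟨ ones m i ⟩
      m + i + 0                                                  ≡⟨ e ⟩
      suc L                                                      ∎))))))
    where
    open ≡-Reasoning
    ones : ∀ m i → (m * 0 + i * 1 + 0 * 1) + (m * 1 + i * 0 + 0 * 1) ≡ m + i + 0
    ones = solve-∀

paths-D-summand : ∀ a b k L → a + b ≡ k + L →
  paths S-D L a b ≡ (L C k) * binom (+ (a + b) -ℤ + 2 *ℤ + k) (+ b -ℤ + k)
paths-D-summand a b k L e with difference b k
... | neg b d = begin
  paths S-D L a b                                  ≡⟨ paths-D-unreachable L a b (inj₁ (m+[1+d]≡n⇒m<n d a≡)) ⟩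
  0                                                ≡⟨ trans (cong ((L C k) *_) (binom-neg top d)) (*-zeroʳ (L C k)) ⟨
  (L C k) * binom top -[1+ d ]                     ≡⟨ cong (λ x → (L C k) * binom top x) (pos-minus-neg b d) ⟨
  (L C k) * binom top (+ b -ℤ + k)                 ∎
  where
  open ≡-Reasoning
  top : ℤ
  top = + (a + b) -ℤ + 2 *ℤ + k
  a≡ : L + suc d ≡ a
  a≡ = sym (+-cancelʳ-≡ b a (L + suc d) (trans e (swap b (suc d) L)))
    where
    swap : ∀ b d L → b + d + L ≡ L + d + b
    swap = solve-∀
... | nonneg k m with difference a k
...   | neg a d = begin
  paths S-D L a (k + m)                            ≡⟨ paths-D-unreachable L a (k + m) (inj₂ (inj₁ (m+[1+d]≡n⇒m<n d b≡))) ⟩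
  0                                                ≡⟨ trans (cong ((L C k) *_) (binom-minus-vanish n (2 * k) m short)) (*-zeroʳ (L C k)) ⟨
  (L C k) * binom (+ n -ℤ + (2 * k)) (+ m)         ≡⟨ cong₂ (λ x y → (L C k) * binom (+ n -ℤ x) y) (pos-two-times k) (pos-minus-nonneg k m) ⟨
  (L C k) * binom (+ n -ℤ + 2 *ℤ + k) (+ (k + m) -ℤ + k) ∎
  where
  open ≡-Reasoning
  n : ℕ
  n = a + (k + m)
  short : n < 2 * k + m
  short = m+[1+d]≡n⇒m<n d (widen a d m)
    where
    widen : ∀ a d m → a + (a + suc d + m) + suc d ≡ 2 * (a + suc d) + m
    widen = solve-∀
  b≡ : L + suc d ≡ k + m
  b≡ = trans (cong (_+ suc d) (+-cancelˡ-≡ k L (a + m) (trans (sym e) (shuffle a d m)))) (shuffle′ a d m)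
    where
    shuffle : ∀ a d m → a + (a + suc d + m) ≡ a + suc d + (a + m)
    shuffle = solve-∀
    shuffle′ : ∀ a d m → a + m + suc d ≡ a + suc d + m
    shuffle′ = solve-∀
...   | nonneg k i = begin
  paths S-D L (k + i) (k + m)                      ≡⟨ cong (λ L → paths S-D L (k + i) (k + m)) L≡ ⟩
  paths S-D (m + i + k) (k + i) (k + m)            ≡⟨ paths-D-trinomial m i k ⟩
  ((m + i + k) C (m + i)) * ((m + i) C m)          ≡⟨ cong₂ _*_ (trans (C-sym (m + i) k) (cong (_C k) (sym L≡))) (cong (_C m) (+-comm m i)) ⟩
  (L C k) * ((i + m) C m)                          ≡⟨ cong (λ x → (L C k) * binom x (+ m)) (pos-minus (2 * k) (i + m) (regroup k i m)) ⟨
  (L C k) * binom (+ n -ℤ + (2 * k)) (+ m)         ≡⟨ cong₂ (λ x y → (L C k) * binom (+ n -ℤ x) y) (pos-two-times k) (pos-minus-nonneg k m) ⟨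
  (L C k) * binom (+ n -ℤ + 2 *ℤ + k) (+ (k + m) -ℤ + k) ∎
  where
  open ≡-Reasoning
  n : ℕ
  n = k + i + (k + m)
  regroup : ∀ k i m → k + i + (k + m) ≡ 2 * k + (i + m)
  regroup = solve-∀
  L≡ : L ≡ m + i + k
  L≡ = +-cancelˡ-≡ k L (m + i + k) (trans (sym e) (shuffle k i m))
    where
    shuffle : ∀ k i m → k + i + (k + m) ≡ k + (m + i + k)
    shuffle = solve-∀

D-closed : ∀ a b →
  D a b ≡ Σ< (λ k → binom (+ a +ℤ + b -ℤ + k) (+ k) * binom (+ a +ℤ + b -ℤ + 2 *ℤ + k) (+ b -ℤ + k)) (a + b + 1)
D-closed a b = begin
  Σ< (λ L → paths S-D L a b) (suc (a + b))           ≡⟨ Σ<-reverse _ (suc (a + b)) ⟩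
  Σ< (λ k → paths S-D (a + b ∸ k) a b) (suc (a + b)) ≡⟨ Σ<-cong (suc (a + b)) term ⟩
  Σ< T (suc (a + b))                                 ≡⟨ cong (Σ< T) (+-comm 1 (a + b)) ⟩
  Σ< T (a + b + 1)                                   ∎
  where
  open ≡-Reasoning
  T : ℕ → ℕ
  T = λ k → binom (+ a +ℤ + b -ℤ + k) (+ k) * binom (+ a +ℤ + b -ℤ + 2 *ℤ + k) (+ b -ℤ + k)
  term : ∀ k → k < suc (a + b) → paths S-D (a + b ∸ k) a b ≡ T k
  term k k<1+n = trans (paths-D-summand a b k L e) (cong (λ x → binom x (+ k) * binom (+ (a + b) -ℤ + 2 *ℤ + k) (+ b -ℤ + k)) (sym (pos-minus k L e)))
    where
    L : ℕ
    L = a + b ∸ k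
    e : a + b ≡ k + L
    e = sym (m+[n∸m]≡n (s≤s⁻¹ k<1+n))

Unreachable-D′ : ℕ → ℕ → ℕ → Set
Unreachable-D′ L a b = L < a ⊎ a + b < L

backClosed-D′ : BackClosed S-D′ Unreachable-D′
backClosed-D′ = step-10 ∷ step-11 ∷ step-01 ∷ step-02 ∷ []
  where
  step-10 : ∀ {L a b} → Unreachable-D′ (suc L) (1 + a) b → Unreachable-D′ L a b
  step-10 (inj₁ L<a)   = inj₁ (s<s⁻¹ L<a)
  step-10 (inj₂ a+b<L) = inj₂ (s<s⁻¹ a+b<L)
  step-11 : ∀ {L a b} → Unreachable-D′ (suc L) (1 + a) (1 + b) → Unreachable-D′ L a b
  step-11 (inj₁ L<a)           = inj₁ (s<s⁻¹ L<a)
  step-11 {a = a} (inj₂ a+b<L) = inj₂ (≤-<-trans (+-monoʳ-≤ a (n≤1+n _)) (s<s⁻¹ a+b<L))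
  step-01 : ∀ {L a b} → Unreachable-D′ (suc L) a (1 + b) → Unreachable-D′ L a b
  step-01 (inj₁ L<a)               = inj₁ (<-trans (n<1+n _) L<a)
  step-01 {L} {a} {b} (inj₂ a+b<L) = inj₂ (s<s⁻¹ (subst (_< suc L) (+-suc a b) a+b<L))
  step-02 : ∀ {L a b} → Unreachable-D′ (suc L) a (2 + b) → Unreachable-D′ L a b
  step-02 (inj₁ L<a)               = inj₁ (<-trans (n<1+n _) L<a)
  step-02 {L} {a} {b} (inj₂ a+b<L) =
    inj₂ (≤-<-trans (+-monoʳ-≤ a (n≤1+n b)) (s<s⁻¹ (subst (_< suc L) (+-suc a (suc b)) a+b<L)))

paths-D′-unreachable : ∀ L a b → Unreachable-D′ L a b → paths S-D′ L a b ≡ 0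
paths-D′-unreachable = paths-vanish S-D′ Unreachable-D′ (λ { (inj₁ ()) ; (inj₂ ()) }) backClosed-D′

module D′-LastStep (L : ℕ) (IH : ∀ a u e → a + u ≡ L → paths S-D′ L a (u + e) ≡ (L C a) * (L C e)) where

  F : ℕ → ℕ → ℕ
  F = paths S-D′ L

  step-10 : ∀ a u e → a + u ≡ suc L → back 1 0 F a (u + e) ≡ atPred (L C_) a * (L C e)
  step-10 zero    u e _  = refl
  step-10 (suc a) u e eq = IH a u e (suc-injective eq)

  step-11 : ∀ a u e → a + u ≡ suc L → back 1 1 F a (u + e) ≡ atPred (L C_) a * atPred (L C_) e
  step-11 zero    u e       _  = refl
  step-11 (suc a) u (suc e) eq = trans (cong (back 0 1 F a) (+-suc u e)) (IH a u e (suc-injective eq))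
  step-11 (suc a) u zero    eq = trans (back-vanish 0 1 F a (u + 0) vanish) (sym (*-zeroʳ (L C a)))
    where
    vanish : ∀ a′ b → a ≡ a′ → u + 0 ≡ 1 + b → F a′ b ≡ 0
    vanish a′ b refl eb = paths-D′-unreachable L a b (inj₂ (≤-reflexive (begin
      suc (a + b)   ≡⟨ +-suc a b ⟨
      a + suc b     ≡⟨ cong (λ n → a + n) (trans (sym eb) (+-identityʳ u)) ⟩
      a + u         ≡⟨ suc-injective eq ⟩
      L             ∎)))
      where open ≡-Reasoning

  step-01 : ∀ a u e → a + u ≡ suc L → back 0 1 F a (u + e) ≡ (L C a) * (L C e)
  step-01 a (suc u) e eq = IH a u e (suc-injective (trans (sym (+-suc a u)) eq))
  step-01 a zero    e eq = trans (back-vanish 0 1 F a e (λ { a′ b refl _ → paths-D′-unreachable L a b (inj₁ L<a) }))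
                                 (sym (cong (_* (L C e)) (k>n⇒nCk≡0 L<a)))
    where
    L<a : L < a
    L<a = ≤-reflexive (sym (trans (sym (+-identityʳ a)) eq))

  step-02 : ∀ a u e → a + u ≡ suc L → back 0 2 F a (u + e) ≡ (L C a) * atPred (L C_) e
  step-02 a (suc u) (suc e) eq = trans (cong (back 0 1 F a) (+-suc u e)) (IH a u e (suc-injective (trans (sym (+-suc a u)) eq)))
  step-02 a (suc u) zero    eq = trans (back-vanish 0 2 F a (suc u + 0) vanish) (sym (*-zeroʳ (L C a)))
    where
    vanish : ∀ a′ b → a ≡ a′ → suc u + 0 ≡ 2 + b → F a′ b ≡ 0
    vanish a′ b refl eb = paths-D′-unreachable L a b (inj₂ (≤-reflexive (begin
      suc (a + b)   ≡⟨ +-suc a b ⟨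
      a + suc b     ≡⟨ cong (λ n → a + n) (trans (sym (suc-injective eb)) (+-identityʳ u)) ⟩
      a + u         ≡⟨ suc-injective (trans (sym (+-suc a u)) eq) ⟩
      L             ∎)))
      where open ≡-Reasoning
  step-02 a zero    e       eq = trans (back-vanish 0 2 F a e (λ { a′ b refl _ → paths-D′-unreachable L a b (inj₁ L<a) }))
                                       (sym (cong (_* atPred (L C_) e) (k>n⇒nCk≡0 L<a)))
    where
    L<a : L < a
    L<a = ≤-reflexive (sym (trans (sym (+-identityʳ a)) eq))

-- a of the L steps are (1 , _), and e of them are (1 , 1) or (0 , 2)
paths-D′-product : ∀ L a u e → a + u ≡ L → paths S-D′ L a (u + e) ≡ (L C a) * (L C e)
paths-D′-product zero    zero zero zero    refl = refl
paths-D′-product zero    zero zero (suc e) refl = refl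
paths-D′-product (suc L) a    u    e       eq   = begin
  paths S-D′ (suc L) a (u + e)
    ≡⟨ paths-suc S-D′ L a (u + e) ⟩
  back 1 0 F a (u + e) + (back 1 1 F a (u + e) + (back 0 1 F a (u + e) + (back 0 2 F a (u + e) + 0)))
    ≡⟨ cong₂ _+_ (step-10 a u e eq) (cong₂ _+_ (step-11 a u e eq) (cong₂ _+_ (step-01 a u e eq) (cong (_+ 0) (step-02 a u e eq)))) ⟩
  A′ * E + (A′ * E′ + (A * E + (A * E′ + 0)))
    ≡⟨ expand A′ A E′ E ⟩
  (A′ + A) * (E′ + E)
    ≡⟨ cong₂ _*_ (C-suc L a) (C-suc L e) ⟨
  (suc L C a) * (suc L C e) ∎
  where
  open ≡-Reasoning
  open D′-LastStep L (paths-D′-product L)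
  A′ A E′ E : ℕ
  A′ = atPred (L C_) a
  A  = L C a
  E′ = atPred (L C_) e
  E  = L C e
  expand : ∀ x₁ x₂ y₁ y₂ → x₁ * y₂ + (x₁ * y₁ + (x₂ * y₂ + (x₂ * y₁ + 0))) ≡ (x₁ + x₂) * (y₁ + y₂)
  expand = solve-∀

paths-D′-summand : ∀ a b L → L ≤ a + b → paths S-D′ L a b ≡ binom (+ L) (+ a +ℤ + b -ℤ + L) * binom (+ L) (+ a)
paths-D′-summand a b L L≤a+b with difference L a
... | neg L d = begin
  paths S-D′ L (L + suc d) b ≡⟨ paths-D′-unreachable L (L + suc d) b (inj₁ L<a) ⟩
  0                          ≡⟨ *-zeroʳ first ⟨
  first * 0                    ≡⟨ cong (first *_) (k>n⇒nCk≡0 L<a) ⟨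
  first * (L C (L + suc d))    ∎
  where
  open ≡-Reasoning
  first : ℕ
  first = binom (+ L) (+ (L + suc d + b) -ℤ + L)
  L<a : L < L + suc d
  L<a = m+[1+d]≡n⇒m<n d refl
... | nonneg a u with difference b u
...   | neg b d     = contradiction (+-cancelˡ-≤ a (b + suc d) b L≤a+b) (<⇒≱ (m+[1+d]≡n⇒m<n d refl))
...   | nonneg u e  = begin
  paths S-D′ (a + u) a (u + e)                    ≡⟨ paths-D′-product (a + u) a u e refl ⟩
  ((a + u) C a) * ((a + u) C e)                   ≡⟨ *-comm ((a + u) C a) _ ⟩
  ((a + u) C e) * ((a + u) C a)                   ≡⟨ cong (λ x → binom (+ (a + u)) x * ((a + u) C a)) (pos-minus (a + u) e (sym (+-assoc a u e))) ⟨
  binom (+ (a + u)) (+ (a + (u + e)) -ℤ + (a + u)) * ((a + u) C a) ∎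
  where open ≡-Reasoning

D′-closed : ∀ a b → D′ a b ≡ Σ< (λ k → binom (+ k) (+ a +ℤ + b -ℤ + k) * binom (+ k) (+ a)) (a + b + 1)
D′-closed a b = trans (Σ<-cong (suc (a + b)) (λ L L<1+n → paths-D′-summand a b L (s≤s⁻¹ L<1+n)))
                     (cong (Σ< (λ k → binom (+ k) (+ a +ℤ + b -ℤ + k) * binom (+ k) (+ a))) (+-comm 1 (a + b)))

-- (L , a , b) = (p + q + r , 2p + q , p + 2q + r) has a solution p, q, r in ℕ exactly when none of these holds.
Unreachable-D″ : ℕ → ℕ → ℕ → Set
Unreachable-D″ L a b = b < L ⊎ a + L < b ⊎ 3 * L < a + b ⊎ (L + a + b) % 2 ≡ 1

back-step-D″ : ∀ x y′ k → suc y′ ≤ suc x → x + suc y′ ≤ 3 → 1 + x + suc y′ ≡ k * 2 →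
               ∀ {L a b} → Unreachable-D″ (suc L) (x + a) (suc y′ + b) → Unreachable-D″ L a b
back-step-D″ x y′ k _     _     _    {b = b} (inj₁ b<L) = inj₁ (≤-<-trans (m≤n+m b y′) (s<s⁻¹ b<L))
back-step-D″ x y′ k y≤1+x _     _    {L} {a} {b} (inj₂ (inj₁ a+L<b)) =
  inj₂ (inj₁ (<-unshift (suc x) (suc y′) a+L<b (shift x a L) (+-comm b (suc y′)) y≤1+x))
  where
  shift : ∀ x a L → a + L + suc x ≡ x + a + suc L
  shift = solve-∀
back-step-D″ x y′ k _     x+y≤3 _    {L} {a} {b} (inj₂ (inj₂ (inj₁ 3L<a+b))) =
  inj₂ (inj₂ (inj₁ (<-unshift 3 (x + suc y′) 3L<a+b (shiftˡ L) (shiftʳ x y′ a b) x+y≤3)))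
  where
  shiftˡ : ∀ L → 3 * L + 3 ≡ 3 * suc L
  shiftˡ = solve-∀
  shiftʳ : ∀ x y′ a b → a + b + (x + suc y′) ≡ x + a + (suc y′ + b)
  shiftʳ = solve-∀
back-step-D″ x y′ k _     _     even {L} {a} {b} (inj₂ (inj₂ (inj₂ odd))) =
  inj₂ (inj₂ (inj₂ (odd-unshift k odd (trans (cong (λ m → L + a + b + m) (sym even)) (shift x y′ L a b)))))
  where
  shift : ∀ x y′ L a b → L + a + b + (1 + x + suc y′) ≡ suc L + (x + a) + (suc y′ + b)
  shift = solve-∀

backClosed-D″ : BackClosed S-D″ Unreachable-D″
backClosed-D″ = back-step-D″ 2 0 2 (s≤s z≤n) ≤-refl refl
              ∷ back-step-D″ 1 1 2 ≤-refl ≤-refl refl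
              ∷ back-step-D″ 0 0 1 ≤-refl (s≤s z≤n) refl
              ∷ []

paths-D″-unreachable : ∀ L a b → Unreachable-D″ L a b → paths S-D″ L a b ≡ 0
paths-D″-unreachable = paths-vanish S-D″ Unreachable-D″
  (λ { (inj₁ ()) ; (inj₂ (inj₁ ())) ; (inj₂ (inj₂ (inj₁ ()))) ; (inj₂ (inj₂ (inj₂ ()))) }) backClosed-D″

open TrinomialCount (paths S-D″) 2 1 1 2 0 1 using () renaming (trinomial-count to paths-D″-count)

-- p steps (2 , 1), q steps (1 , 2) and r steps (0 , 1)
paths-D″-trinomial : ∀ p q r → paths S-D″ (p + q + r) (p + q + p) (p + q + q + r) ≡ trinomial p q r
paths-D″-trinomial p q r = trans (cong₂ (paths S-D″ (p + q + r)) (end₁ p q r) (end₂ p q r)) (paths-D″-count refl rec no-21 no-12 no-01 p q r)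
  where
  open ≡-Reasoning
  end₁ : ∀ p q r → p + q + p ≡ p * 2 + q * 1 + r * 0
  end₁ = solve-∀
  end₂ : ∀ p q r → p + q + q + r ≡ p * 1 + q * 2 + r * 1
  end₂ = solve-∀
  rec : ∀ L a b → paths S-D″ (suc L) a b ≡ back 2 1 (paths S-D″ L) a b + back 1 2 (paths S-D″ L) a b + back 0 1 (paths S-D″ L) a b
  rec L a b = trans (paths-suc S-D″ L a b) (reassoc (back 2 1 (paths S-D″ L) a b) (back 1 2 (paths S-D″ L) a b) (back 0 1 (paths S-D″ L) a b))
    where
    reassoc : ∀ x y z → x + (y + (z + 0)) ≡ x + y + z
    reassoc = solve-∀
  no-21 : ∀ L q r a b → q + r ≡ suc L → q * 1 + r * 0 ≡ 2 + a → q * 2 + r * 1 ≡ 1 + b → paths S-D″ L a b ≡ 0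
  no-21 L q r a b e ea eb = paths-D″-unreachable L a b (inj₂ (inj₁ (m+[1+d]≡n⇒m<n 1 (suc-injective (begin
    suc (a + L + 2)               ≡⟨ reorder a L ⟩
    (2 + a) + suc L               ≡⟨ cong₂ _+_ ea e ⟨
    (q * 1 + r * 0) + (q + r)     ≡⟨ collect q r ⟩
    q * 2 + r * 1                 ≡⟨ eb ⟩
    1 + b                         ∎)))))
    where
    reorder : ∀ a L → suc (a + L + 2) ≡ (2 + a) + suc L
    reorder = solve-∀
    collect : ∀ q r → (q * 1 + r * 0) + (q + r) ≡ q * 2 + r * 1
    collect = solve-∀
  no-12 : ∀ L p r a b → p + 0 + r ≡ suc L → p * 2 + 0 * 1 + r * 0 ≡ 1 + a → p * 1 + 0 * 2 + r * 1 ≡ 2 + b → paths S-D″ L a b ≡ 0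
  no-12 L p r a b e ea eb = paths-D″-unreachable L a b (inj₁ (≤-reflexive (suc-injective (begin
    2 + b                         ≡⟨ eb ⟨
    p * 1 + 0 * 2 + r * 1         ≡⟨ ones p r ⟩
    p + 0 + r                     ≡⟨ e ⟩
    suc L                         ∎))))
    where
    ones : ∀ p r → p * 1 + 0 * 2 + r * 1 ≡ p + 0 + r
    ones = solve-∀
  no-01 : ∀ L p q a b → p + q + 0 ≡ suc L → p * 2 + q * 1 + 0 * 0 ≡ a → p * 1 + q * 2 + 0 * 1 ≡ 1 + b → paths S-D″ L a b ≡ 0
  no-01 L p q a b e ea eb = paths-D″-unreachable L a b (inj₂ (inj₂ (inj₁ (m+[1+d]≡n⇒m<n 1 (suc-injective (begin
    suc (3 * L + 2)                                        ≡⟨ triple L ⟩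
    3 * suc L                                              ≡⟨ cong (3 *_) e ⟨
    3 * (p + q + 0)                                        ≡⟨ split p q ⟩
    (p * 2 + q * 1 + 0 * 0) + (p * 1 + q * 2 + 0 * 1)      ≡⟨ cong₂ _+_ ea eb ⟩
    a + (1 + b)                                            ≡⟨ +-suc a b ⟩
    suc (a + b)                                            ∎))))))
    where
    triple : ∀ L → suc (3 * L + 2) ≡ 3 * suc L
    triple = solve-∀
    split : ∀ p q → 3 * (p + q + 0) ≡ (p * 2 + q * 1 + 0 * 0) + (p * 1 + q * 2 + 0 * 1)
    split = solve-∀

paths-D″-summand : ∀ a b k L → a + b ≡ 2 * k + L → paths S-D″ L a b ≡ (L C k) * binom (+ k) (+ a -ℤ + k)
paths-D″-summand a b k L e with difference a k
... | neg a d = begin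
  paths S-D″ L a b                        ≡⟨ paths-D″-unreachable L a b (inj₂ (inj₁ (m+[1+d]≡n⇒m<n (d + suc d) b≡))) ⟩
  0                                       ≡⟨ *-zeroʳ (L C k) ⟨
  (L C k) * 0                             ≡⟨ cong (λ x → (L C k) * binom (+ k) x) (pos-minus-neg a d) ⟨
  (L C k) * binom (+ k) (+ a -ℤ + k)      ∎
  where
  open ≡-Reasoning
  b≡ : a + L + suc (d + suc d) ≡ b
  b≡ = +-cancelˡ-≡ a _ b (trans (regroup a d L) (sym e))
    where
    regroup : ∀ a d L → a + (a + L + suc (d + suc d)) ≡ 2 * (a + suc d) + L
    regroup = solve-∀
... | nonneg k p with difference L k
...   | neg L d = begin
  paths S-D″ L (L + suc d + p) b          ≡⟨ paths-D″-unreachable L _ b (inj₂ (inj₂ (inj₁ 3L<a+b))) ⟩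
  0                                       ≡⟨ cong (_* binom (+ k) (+ (k + p) -ℤ + k)) (k>n⇒nCk≡0 (m+[1+d]≡n⇒m<n {L} d refl)) ⟨
  (L C k) * binom (+ k) (+ (k + p) -ℤ + k) ∎
  where
  open ≡-Reasoning
  3L<a+b : 3 * L < L + suc d + p + b
  3L<a+b = m+[1+d]≡n⇒m<n (suc (2 * d)) (trans (regroup L d) (sym e))
    where
    regroup : ∀ L d → 3 * L + suc (suc (2 * d)) ≡ 2 * (L + suc d) + L
    regroup = solve-∀
...   | nonneg k r with difference k p
...     | neg k d = begin
  paths S-D″ (k + r) a b                  ≡⟨ paths-D″-unreachable (k + r) a b (inj₁ (m+[1+d]≡n⇒m<n d L≡)) ⟩
  0                                       ≡⟨ *-zeroʳ ((k + r) C k) ⟨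
  ((k + r) C k) * 0                       ≡⟨ cong (((k + r) C k) *_) (k>n⇒nCk≡0 (m+[1+d]≡n⇒m<n {k} d refl)) ⟨
  ((k + r) C k) * (k C (k + suc d))       ≡⟨ cong (λ x → ((k + r) C k) * binom (+ k) x) (pos-minus-nonneg k (k + suc d)) ⟨
  ((k + r) C k) * binom (+ k) (+ a -ℤ + k) ∎
  where
  open ≡-Reasoning
  L≡ : b + suc d ≡ k + r
  L≡ = +-cancelˡ-≡ (2 * k) _ (k + r) (trans (regroup k d b) e)
    where
    regroup : ∀ k d b → 2 * k + (b + suc d) ≡ k + (k + suc d) + b
    regroup = solve-∀
...     | nonneg p q = begin
  paths S-D″ (p + q + r) (p + q + p) b             ≡⟨ cong (paths S-D″ (p + q + r) (p + q + p)) b≡ ⟩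
  paths S-D″ (p + q + r) (p + q + p) (p + q + q + r) ≡⟨ paths-D″-trinomial p q r ⟩
  ((p + q + r) C (p + q)) * ((p + q) C p)          ≡⟨ cong (λ x → ((p + q + r) C (p + q)) * binom (+ (p + q)) x) (pos-minus-nonneg (p + q) p) ⟨
  ((p + q + r) C (p + q)) * binom (+ (p + q)) (+ (p + q + p) -ℤ + (p + q)) ∎
  where
  open ≡-Reasoning
  b≡ : b ≡ p + q + q + r
  b≡ = +-cancelˡ-≡ (p + q + p) b _ (trans e (regroup p q r))
    where
    regroup : ∀ p q r → 2 * (p + q) + (p + q + r) ≡ p + q + p + (p + q + q + r)
    regroup = solve-∀

D″-closed : ∀ a b →
  D″ a b ≡ Σ< (λ k → binom (+ a +ℤ + b -ℤ + 2 *ℤ + k) (+ k) * binom (+ k) (+ a -ℤ + k)) (a + b + 1)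
D″-closed a b = begin
  Σ< (λ L → paths S-D″ L a b) (suc N)                ≡⟨ Σ<-same-parity _ N odd-offset ⟩
  Σ< (λ k → paths S-D″ (N ∸ 2 * k) a b) (N / 2 + 1)  ≡⟨ Σ<-cong (N / 2 + 1) term ⟩
  Σ< T (N / 2 + 1)                                   ≡⟨ Σ<-truncate (+-monoˡ-≤ 1 (m/n≤m N 2)) beyond ⟨
  Σ< T (N + 1)                                       ∎
  where
  open ≡-Reasoning
  N : ℕ
  N = a + b
  T : ℕ → ℕ
  T = λ k → binom (+ a +ℤ + b -ℤ + 2 *ℤ + k) (+ k) * binom (+ k) (+ a -ℤ + k)
  first-factor : ∀ k L → N ≡ 2 * k + L → binom (+ N -ℤ + 2 *ℤ + k) (+ k) ≡ L C k
  first-factor k L e = cong (λ x → binom x (+ k)) (trans (cong (λ x → + N -ℤ x) (pos-two-times k)) (pos-minus (2 * k) L e))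
  odd-offset : ∀ L j → L + suc (2 * j) ≡ N → paths S-D″ L a b ≡ 0
  odd-offset L j e = paths-D″-unreachable L a b (inj₂ (inj₂ (inj₂ (trans (cong (_% 2) (begin
    L + a + b                ≡⟨ +-assoc L a b ⟩
    L + N                    ≡⟨ cong (λ n → L + n) e ⟨
    L + (L + suc (2 * j))    ≡⟨ regroup L j ⟩
    1 + (L + j) * 2          ∎)) ([m+kn]%n≡m%n 1 (L + j) 2)))))
    where
    regroup : ∀ L j → L + (L + suc (2 * j)) ≡ 1 + (L + j) * 2
    regroup = solve-∀
  term : ∀ k → k < N / 2 + 1 → paths S-D″ (N ∸ 2 * k) a b ≡ T k
  term k k<N/2+1 = trans (paths-D″-summand a b k L e) (cong (_* binom (+ k) (+ a -ℤ + k)) (sym (first-factor k L e)))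
    where
    L : ℕ
    L = N ∸ 2 * k
    e : N ≡ 2 * k + L
    e = sym (m+[n∸m]≡n (k≤n/d⇒d*k≤n N 2 k (m<n+1⇒m≤n k<N/2+1)))
  beyond : ∀ k → N / 2 + 1 ≤ k → k < N + 1 → T k ≡ 0
  beyond k N/2+1≤k _ = cong (_* binom (+ k) (+ a -ℤ + k)) (trans (cong (λ x → binom (+ N -ℤ x) (+ k)) (pos-two-times k))
    (binom-minus-vanish N (2 * k) k (<-≤-trans (n/d<k⇒n<d*k N 2 k (m+1≤n⇒m<n N/2+1≤k)) (m≤m+n (2 * k) k))))

coeff-⊕ : ∀ p q j → coeff (p ⊕ q) j ≡ coeff p j + coeff q j
coeff-⊕ []      q       j       = refl
coeff-⊕ (a ∷ p) []      j       = sym (+-identityʳ _)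
coeff-⊕ (a ∷ p) (b ∷ q) zero    = refl
coeff-⊕ (a ∷ p) (b ∷ q) (suc j) = coeff-⊕ p q j

coeff-map-* : ∀ c q j → coeff (map (c *_) q) j ≡ c * coeff q j
coeff-map-* c []      j       = sym (*-zeroʳ c)
coeff-map-* c (x ∷ q) zero    = refl
coeff-map-* c (x ∷ q) (suc j) = coeff-map-* c q j

convolve : (ℕ → ℕ) → Poly → ℕ → ℕ
convolve f q zero    = f 0 * coeff q 0
convolve f q (suc j) = f 0 * coeff q (suc j) + convolve (λ i → f (suc i)) q j

convolve-cong : ∀ {f g} q → (∀ i → f i ≡ g i) → ∀ j → convolve f q j ≡ convolve g q j
convolve-cong q f≗g zero    = cong (_* coeff q 0) (f≗g 0)
convolve-cong q f≗g (suc j) = cong₂ _+_ (cong (_* coeff q (suc j)) (f≗g 0)) (convolve-cong q (λ i → f≗g (suc i)) j)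

convolve-zero : ∀ q j → convolve (λ _ → 0) q j ≡ 0
convolve-zero q zero    = refl
convolve-zero q (suc j) = convolve-zero q j

convolve-const : ∀ c q j → convolve (coeff (const c)) q j ≡ c * coeff q j
convolve-const c q zero    = refl
convolve-const c q (suc j) = trans (cong (λ n → c * coeff q (suc j) + n) (convolve-zero q j)) (+-identityʳ _)

convolve-scale : ∀ c f q j → convolve (λ i → c * f i) q j ≡ c * convolve f q j
convolve-scale c f q zero    = *-assoc c (f 0) _
convolve-scale c f q (suc j) = begin
  c * f 0 * coeff q (suc j) + convolve (λ i → c * f (suc i)) q j   ≡⟨ cong₂ _+_ (*-assoc c (f 0) _) (convolve-scale c (λ i → f (suc i)) q j) ⟩
  c * (f 0 * coeff q (suc j)) + c * convolve (λ i → f (suc i)) q j ≡⟨ *-distribˡ-+ c _ _ ⟨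
  c * (f 0 * coeff q (suc j) + convolve (λ i → f (suc i)) q j)     ∎
  where open ≡-Reasoning

coeff-⊗ : ∀ p q j → coeff (p ⊗ q) j ≡ convolve (coeff p) q j
coeff-⊗ []      q j       = sym (convolve-zero q j)
coeff-⊗ (a ∷ p) q zero    = trans (coeff-⊕ (map (a *_) q) _ 0) (trans (+-identityʳ _) (coeff-map-* a q 0))
coeff-⊗ (a ∷ p) q (suc j) = trans (coeff-⊕ (map (a *_) q) _ (suc j)) (cong₂ _+_ (coeff-map-* a q (suc j)) (coeff-⊗ p q j))

shiftedAt : ℕ → (ℕ → ℕ) → ℕ → ℕ
shiftedAt zero    g j       = g j
shiftedAt (suc m) g zero    = 0
shiftedAt (suc m) g (suc j) = shiftedAt m g j

shiftedAt-+ : ∀ m g t → shiftedAt m g (m + t) ≡ g t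
shiftedAt-+ zero    g t = refl
shiftedAt-+ (suc m) g t = shiftedAt-+ m g t

shiftedAt-< : ∀ m g j → j < m → shiftedAt m g j ≡ 0
shiftedAt-< (suc m) g zero    _   = refl
shiftedAt-< (suc m) g (suc j) j<m = shiftedAt-< m g j (s≤s⁻¹ j<m)

shiftedAt-beyond : ∀ m e j → m + e < j → shiftedAt m (e C_) j ≡ 0
shiftedAt-beyond zero    e j       e<j     = k>n⇒nCk≡0 e<j
shiftedAt-beyond (suc m) e (suc j) m+e<j = shiftedAt-beyond m e j (s≤s⁻¹ m+e<j)

binom-shiftedAt : ∀ m e j → binom (+ e) (+ j -ℤ + m) ≡ shiftedAt m (e C_) j
binom-shiftedAt m e j with difference j m
... | nonneg m t = trans (cong (binom (+ e)) (pos-minus-nonneg m t)) (sym (shiftedAt-+ m (e C_) t))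
... | neg j d    = trans (cong (binom (+ e)) (pos-minus-neg j d)) (sym (shiftedAt-< (j + suc d) (e C_) j (m+[1+d]≡n⇒m<n d refl)))

coeff-Xᵐ-suc : ∀ m i → coeff (X ^P suc m) (suc i) ≡ coeff (X ^P m) i
coeff-Xᵐ-suc m i = trans (coeff-⊗ X (X ^P m) (suc i)) (trans (convolve-const 1 (X ^P m) i) (*-identityˡ _))

convolve-Xᵐ : ∀ m q j → convolve (coeff (X ^P m)) q j ≡ shiftedAt m (coeff q) j
convolve-Xᵐ zero    q j       = trans (convolve-const 1 q j) (*-identityˡ _)
convolve-Xᵐ (suc m) q zero    = cong (_* coeff q 0) (coeff-⊗ X (X ^P m) 0)
convolve-Xᵐ (suc m) q (suc j) = begin
  coeff (X ^P suc m) 0 * coeff q (suc j) + convolve (λ i → coeff (X ^P suc m) (suc i)) q j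
    ≡⟨ cong₂ _+_ (cong (_* coeff q (suc j)) (coeff-⊗ X (X ^P m) 0)) (convolve-cong q (coeff-Xᵐ-suc m) j) ⟩
  convolve (coeff (X ^P m)) q j
    ≡⟨ convolve-Xᵐ m q j ⟩
  shiftedAt m (coeff q) j ∎
  where open ≡-Reasoning

coeff-[1+X]ᵉ : ∀ e j → coeff (1+X ^P e) j ≡ e C j
coeff-[1+X]ᵉ zero    zero    = refl
coeff-[1+X]ᵉ zero    (suc j) = refl
coeff-[1+X]ᵉ (suc e) zero    = trans (coeff-⊗ 1+X (1+X ^P e) 0) (trans (*-identityˡ _) (coeff-[1+X]ᵉ e 0))
coeff-[1+X]ᵉ (suc e) (suc j) = begin
  coeff (1+X ^P suc e) (suc j)                        ≡⟨ coeff-⊗ 1+X (1+X ^P e) (suc j) ⟩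
  1 * coeff (1+X ^P e) (suc j) + convolve (coeff (const 1)) (1+X ^P e) j
                                                      ≡⟨ cong₂ _+_ (*-identityˡ _) (trans (convolve-const 1 _ j) (*-identityˡ _)) ⟩
  coeff (1+X ^P e) (suc j) + coeff (1+X ^P e) j       ≡⟨ cong₂ _+_ (coeff-[1+X]ᵉ e (suc j)) (coeff-[1+X]ᵉ e j) ⟩
  e C suc j + e C j                                   ≡⟨ +-comm (e C suc j) _ ⟩
  e C j + e C suc j                                   ≡⟨ nCk+nC[k+1]≡[n+1]C[k+1] e j ⟩
  suc e C suc j                                       ∎
  where open ≡-Reasoning

coeff-cXᵐ[1+X]ᵉ : ∀ c m e j → coeff (const c ⊗ (X ^P m) ⊗ (1+X ^P e)) j ≡ c * shiftedAt m (e C_) j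
coeff-cXᵐ[1+X]ᵉ c m e j = begin
  coeff (const c ⊗ (X ^P m) ⊗ (1+X ^P e)) j             ≡⟨ coeff-⊗ (const c ⊗ (X ^P m)) _ j ⟩
  convolve (coeff (const c ⊗ (X ^P m))) (1+X ^P e) j    ≡⟨ convolve-cong _ (λ i → trans (coeff-⊗ (const c) (X ^P m) i) (convolve-const c _ i)) j ⟩
  convolve (λ i → c * coeff (X ^P m) i) (1+X ^P e) j    ≡⟨ convolve-scale c _ _ j ⟩
  c * convolve (coeff (X ^P m)) (1+X ^P e) j            ≡⟨ cong (c *_) (convolve-Xᵐ m _ j) ⟩
  c * shiftedAt m (coeff (1+X ^P e)) j                  ≡⟨ cong (c *_) (shiftedAt-cong m (coeff-[1+X]ᵉ e) j) ⟩
  c * shiftedAt m (e C_) j                              ∎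
  where
  open ≡-Reasoning
  shiftedAt-cong : ∀ m {f g} → (∀ i → f i ≡ g i) → ∀ j → shiftedAt m f j ≡ shiftedAt m g j
  shiftedAt-cong zero    f≗g j       = f≗g j
  shiftedAt-cong (suc m) f≗g zero    = refl
  shiftedAt-cong (suc m) f≗g (suc j) = shiftedAt-cong m f≗g j

coeff-ΣP< : ∀ f n j → coeff (ΣP< f n) j ≡ Σ< (λ k → coeff (f k) j) n
coeff-ΣP< f zero    j = refl
coeff-ΣP< f (suc n) j = trans (coeff-⊕ (ΣP< f n) (f n) j) (cong (_+ coeff (f n) j) (coeff-ΣP< f n j))

coeff-ΣP<-terms : ∀ (c m e : ℕ → ℕ) N j →
  coeff (ΣP< (λ k → const (c k) ⊗ (X ^P m k) ⊗ (1+X ^P e k)) N) j ≡ Σ< (λ k → c k * shiftedAt (m k) (e k C_) j) N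
coeff-ΣP<-terms c m e N j = trans (coeff-ΣP< _ N j) (Σ<-cong N (λ k _ → coeff-cXᵐ[1+X]ᵉ (c k) (m k) (e k) j))

coeff-ΣP<-terms-beyond : ∀ (c m e : ℕ → ℕ) N j → (∀ k → k < N → m k + e k < j) →
  coeff (ΣP< (λ k → const (c k) ⊗ (X ^P m k) ⊗ (1+X ^P e k)) N) j ≡ 0
coeff-ΣP<-terms-beyond c m e N j deg<j = trans (coeff-ΣP<-terms c m e N j) (Σ<-zero N vanish)
  where
  vanish : ∀ k → k < N → c k * shiftedAt (m k) (e k C_) j ≡ 0
  vanish k k<N = trans (cong (c k *_) (shiftedAt-beyond (m k) (e k) j (deg<j k k<N))) (*-zeroʳ (c k))

coeff-mono-≡ : ∀ c j → coeff (mono c j) j ≡ c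
coeff-mono-≡ c zero    = refl
coeff-mono-≡ c (suc j) = coeff-mono-≡ c j

coeff-mono-≢ : ∀ c k j → j ≢ k → coeff (mono c k) j ≡ 0
coeff-mono-≢ c zero    zero    j≢k = contradiction refl j≢k
coeff-mono-≢ c zero    (suc j) j≢k = refl
coeff-mono-≢ c (suc k) zero    j≢k = refl
coeff-mono-≢ c (suc k) (suc j) j≢k = coeff-mono-≢ c k j (λ j≡k → j≢k (cong suc j≡k))

generating-≈ : ∀ (G : ℕ → ℕ → ℕ) (R : ℕ → Poly) →
  (∀ i j → coeff (R (i + j)) j ≡ G i j) → (∀ n j → n < j → coeff (R n) j ≡ 0) →
  ∀ n → ΣP< (λ k → mono (G (n ∸ k) k) k) (suc n) ≈P R n
generating-≈ G R coeff-R coeff-R-above n j with difference n j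
... | nonneg j i = begin
  coeff (ΣP< (λ k → mono (G (j + i ∸ k) k) k) (suc (j + i))) j ≡⟨ coeff-ΣP< _ (suc (j + i)) j ⟩
  Σ< (λ k → coeff (mono (G (j + i ∸ k) k) k) j) (suc (j + i))  ≡⟨ Σ<-delta (suc (j + i)) j off-diagonal (s≤s (m≤m+n j i)) ⟩
  coeff (mono (G (j + i ∸ j) j) j) j                            ≡⟨ coeff-mono-≡ _ j ⟩
  G (j + i ∸ j) j                                               ≡⟨ cong (λ x → G x j) (m+n∸m≡n j i) ⟩
  G i j                                                         ≡⟨ coeff-R i j ⟨
  coeff (R (i + j)) j                                           ≡⟨ cong (λ m → coeff (R m) j) (+-comm i j) ⟩
  coeff (R (j + i)) j                                           ∎
  where
  open ≡-Reasoning
  off-diagonal : ∀ k → k ≢ j → coeff (mono (G (j + i ∸ k) k) k) j ≡ 0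
  off-diagonal k k≢j = coeff-mono-≢ _ k j (≢-sym k≢j)
... | neg n d = begin
  coeff (ΣP< (λ k → mono (G (n ∸ k) k) k) (suc n)) (n + suc d)  ≡⟨ coeff-ΣP< _ (suc n) _ ⟩
  Σ< (λ k → coeff (mono (G (n ∸ k) k) k) (n + suc d)) (suc n)   ≡⟨ Σ<-zero (suc n) above-degree ⟩
  0                                                             ≡⟨ coeff-R-above n (n + suc d) (m+[1+d]≡n⇒m<n d refl) ⟨
  coeff (R n) (n + suc d)                                       ∎
  where
  open ≡-Reasoning
  above-degree : ∀ k → k < suc n → coeff (mono (G (n ∸ k) k) k) (n + suc d) ≡ 0
  above-degree k k<1+n = coeff-mono-≢ _ k _ (≢-sym (<⇒≢ (≤-<-trans (s≤s⁻¹ k<1+n) (m+[1+d]≡n⇒m<n d refl))))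

D-summand-coeff : ∀ i j k →
  binom (+ i +ℤ + j -ℤ + k) (+ k) * binom (+ i +ℤ + j -ℤ + 2 *ℤ + k) (+ j -ℤ + k)
    ≡ ((i + j ∸ k) C k) * shiftedAt k ((i + j ∸ 2 * k) C_) j
D-summand-coeff i j k with 2 * k ≤? i + j
... | yes 2k≤n = cong₂ _*_ (first n k) (begin
  binom (+ n -ℤ + 2 *ℤ + k) (+ j -ℤ + k)   ≡⟨ cong (λ x → binom (+ n -ℤ x) (+ j -ℤ + k)) (pos-two-times k) ⟩
  binom (+ n -ℤ + (2 * k)) (+ j -ℤ + k)    ≡⟨ cong (λ x → binom x (+ j -ℤ + k)) (pos-minus (2 * k) _ (sym (m+[n∸m]≡n 2k≤n))) ⟩
  binom (+ (n ∸ 2 * k)) (+ j -ℤ + k)       ≡⟨ binom-shiftedAt k (n ∸ 2 * k) j ⟩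
  shiftedAt k ((n ∸ 2 * k) C_) j           ∎)
  where
  open ≡-Reasoning
  n : ℕ
  n = i + j
  first : ∀ n k → binom (+ n -ℤ + k) (+ k) ≡ (n ∸ k) C k
  first n zero    = refl
  first n (suc k) = binom-minus n (suc k) (suc k) (s≤s z≤n)
... | no 2k≰n = begin
  binom (+ n -ℤ + k) (+ k) * second              ≡⟨ cong (_* second) (binom-minus-vanish n k k (<-double k (≰⇒> 2k≰n))) ⟩
  0                                               ≡⟨ cong (_* shiftedAt k ((n ∸ 2 * k) C_) j) (C-diagonal-vanish n k (≰⇒> 2k≰n)) ⟨
  ((n ∸ k) C k) * shiftedAt k ((n ∸ 2 * k) C_) j ∎
  where
  open ≡-Reasoning
  n : ℕ
  n = i + j
  second : ℕ
  second = binom (+ n -ℤ + 2 *ℤ + k) (+ j -ℤ + k)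

calD-closed : ∀ n → calD n ≈P ΣP< (λ k → const ((n ∸ k) C k) ⊗ (X ^P k) ⊗ (1+X ^P (n ∸ 2 * k))) (n / 2 + 1)
calD-closed = generating-≈ D R coeff-R coeff-R-above
  where
  R : ℕ → Poly
  R n = ΣP< (λ k → const ((n ∸ k) C k) ⊗ (X ^P k) ⊗ (1+X ^P (n ∸ 2 * k))) (n / 2 + 1)
  term : ℕ → ℕ → ℕ → ℕ
  term n j k = ((n ∸ k) C k) * shiftedAt k ((n ∸ 2 * k) C_) j
  coeff-R : ∀ i j → coeff (R (i + j)) j ≡ D i j
  coeff-R i j = begin
    coeff (R n) j                  ≡⟨ coeff-ΣP<-terms (λ k → (n ∸ k) C k) (λ k → k) (λ k → n ∸ 2 * k) (n / 2 + 1) j ⟩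
    Σ< (term n j) (n / 2 + 1)      ≡⟨ Σ<-truncate (+-monoˡ-≤ 1 (m/n≤m n 2)) beyond ⟨
    Σ< (term n j) (n + 1)          ≡⟨ Σ<-cong (n + 1) (λ k _ → D-summand-coeff i j k) ⟨
    Σ< (λ k → binom (+ i +ℤ + j -ℤ + k) (+ k) * binom (+ i +ℤ + j -ℤ + 2 *ℤ + k) (+ j -ℤ + k)) (n + 1)
                                   ≡⟨ D-closed i j ⟨
    D i j                          ∎
    where
    open ≡-Reasoning
    n : ℕ
    n = i + j
    beyond : ∀ k → n / 2 + 1 ≤ k → k < n + 1 → term n j k ≡ 0
    beyond k n/2+1≤k _ = cong (_* shiftedAt k ((n ∸ 2 * k) C_) j) (C-diagonal-vanish n k (n/d<k⇒n<d*k n 2 k (m+1≤n⇒m<n n/2+1≤k)))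
  coeff-R-above : ∀ n j → n < j → coeff (R n) j ≡ 0
  coeff-R-above n j n<j = coeff-ΣP<-terms-beyond (λ k → (n ∸ k) C k) (λ k → k) (λ k → n ∸ 2 * k) (n / 2 + 1) j
    (λ k k<n/2+1 → ≤-<-trans (degree k (≤-trans (m<n+1⇒m≤n k<n/2+1) (m/n≤m n 2))) n<j)
    where
    degree : ∀ k → k ≤ n → k + (n ∸ 2 * k) ≤ n
    degree k k≤n = ≤-trans (+-monoʳ-≤ k (∸-monoʳ-≤ n (m≤m+n k (k + 0)))) (≤-reflexive (m+[n∸m]≡n k≤n))

D′-summand-coeff : ∀ i j k L → i + j ≡ k + L →
  binom (+ L) (+ i +ℤ + j -ℤ + L) * binom (+ L) (+ i) ≡ (L C k) * shiftedAt k (L C_) j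
D′-summand-coeff i j k L e = cong₂ _*_ (cong (binom (+ L)) (pos-minus L k (trans e (+-comm k L)))) (begin
  binom (+ L) (+ i)                ≡⟨ binom-sym L (+ i) ⟩
  binom (+ L) (+ L -ℤ + i)         ≡⟨ cong (binom (+ L)) (pos-minus-swap {i} {j} {k} {L} e) ⟩
  binom (+ L) (+ j -ℤ + k)         ≡⟨ binom-shiftedAt k L j ⟩
  shiftedAt k (L C_) j             ∎)
  where open ≡-Reasoning

calH-closed : ∀ n → calH n ≈P ΣP< (λ k → const ((n ∸ k) C k) ⊗ (X ^P k) ⊗ (1+X ^P (n ∸ k))) (n / 2 + 1)
calH-closed = generating-≈ D′ R coeff-R coeff-R-above
  where
  R : ℕ → Poly
  R n = ΣP< (λ k → const ((n ∸ k) C k) ⊗ (X ^P k) ⊗ (1+X ^P (n ∸ k))) (n / 2 + 1)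
  term : ℕ → ℕ → ℕ → ℕ
  term n j k = ((n ∸ k) C k) * shiftedAt k ((n ∸ k) C_) j
  coeff-R : ∀ i j → coeff (R (i + j)) j ≡ D′ i j
  coeff-R i j = begin
    coeff (R n) j                  ≡⟨ coeff-ΣP<-terms (λ k → (n ∸ k) C k) (λ k → k) (λ k → n ∸ k) (n / 2 + 1) j ⟩
    Σ< (term n j) (n / 2 + 1)      ≡⟨ Σ<-truncate (≤-trans (+-monoˡ-≤ 1 (m/n≤m n 2)) (≤-reflexive (+-comm n 1))) beyond ⟨
    Σ< (term n j) (suc n)          ≡⟨ Σ<-cong (suc n) (λ k k<1+n → D′-summand-coeff i j k (n ∸ k) (sym (m+[n∸m]≡n (s≤s⁻¹ k<1+n)))) ⟨
    Σ< (λ k → T (n ∸ k)) (suc n)   ≡⟨ Σ<-reverse T (suc n) ⟨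
    Σ< T (suc n)                   ≡⟨ cong (Σ< T) (+-comm 1 n) ⟩
    Σ< T (n + 1)                   ≡⟨ D′-closed i j ⟨
    D′ i j                         ∎
    where
    open ≡-Reasoning
    n : ℕ
    n = i + j
    T : ℕ → ℕ
    T = λ L → binom (+ L) (+ i +ℤ + j -ℤ + L) * binom (+ L) (+ i)
    beyond : ∀ k → n / 2 + 1 ≤ k → k < suc n → term n j k ≡ 0
    beyond k n/2+1≤k _ = cong (_* shiftedAt k ((n ∸ k) C_) j) (C-diagonal-vanish n k (n/d<k⇒n<d*k n 2 k (m+1≤n⇒m<n n/2+1≤k)))
  coeff-R-above : ∀ n j → n < j → coeff (R n) j ≡ 0
  coeff-R-above n j n<j = coeff-ΣP<-terms-beyond (λ k → (n ∸ k) C k) (λ k → k) (λ k → n ∸ k) (n / 2 + 1) j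
    (λ k k<n/2+1 → ≤-<-trans (≤-reflexive (m+[n∸m]≡n (≤-trans (m<n+1⇒m≤n k<n/2+1) (m/n≤m n 2)))) n<j)

D″-summand-coeff : ∀ i j k →
  binom (+ i +ℤ + j -ℤ + 2 *ℤ + k) (+ k) * binom (+ k) (+ i -ℤ + k)
    ≡ ((i + j ∸ 2 * k) C k) * shiftedAt (i + j ∸ 2 * k) (k C_) j
D″-summand-coeff i j k with 2 * k ≤? i + j
... | yes 2k≤n = cong₂ _*_ (trans (cong (λ x → binom (+ n -ℤ x) (+ k)) (pos-two-times k)) (first k)) (begin
  binom (+ k) (+ i -ℤ + k)                 ≡⟨ binom-sym k (+ i -ℤ + k) ⟩
  binom (+ k) (+ k -ℤ (+ i -ℤ + k))        ≡⟨ cong (binom (+ k)) reflect ⟩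
  binom (+ k) (+ j -ℤ + (n ∸ 2 * k))       ≡⟨ binom-shiftedAt (n ∸ 2 * k) k j ⟩
  shiftedAt (n ∸ 2 * k) (k C_) j           ∎)
  where
  open ≡-Reasoning
  n : ℕ
  n = i + j
  first : ∀ k → binom (+ n -ℤ + (2 * k)) (+ k) ≡ (n ∸ 2 * k) C k
  first zero    = refl
  first (suc k) = binom-minus n (2 * suc k) (suc k) (s≤s z≤n)
  reflect : + k -ℤ (+ i -ℤ + k) ≡ + j -ℤ + (n ∸ 2 * k)
  reflect = begin
    + k -ℤ (+ i -ℤ + k)                                ≡⟨ regroup (+ i) (+ j) (+ k) ⟩
    + j -ℤ ((+ i +ℤ + j) -ℤ + 2 *ℤ + k)                 ≡⟨ cong (λ x → + j -ℤ (+ n -ℤ x)) (pos-two-times k) ⟩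
    + j -ℤ (+ n -ℤ + (2 * k))                           ≡⟨ cong (λ x → + j -ℤ x) (pos-minus (2 * k) (n ∸ 2 * k) (sym (m+[n∸m]≡n 2k≤n))) ⟩
    + j -ℤ + (n ∸ 2 * k)                                ∎
    where
    regroup : ∀ (i j k : ℤ) → k -ℤ (i -ℤ k) ≡ j -ℤ ((i +ℤ j) -ℤ + 2 *ℤ k)
    regroup = ℤ-Solver.solve-∀
... | no 2k≰n = begin
  binom (+ n -ℤ + 2 *ℤ + k) (+ k) * second                  ≡⟨ cong (λ x → binom (+ n -ℤ x) (+ k) * second) (pos-two-times k) ⟩
  binom (+ n -ℤ + (2 * k)) (+ k) * second                   ≡⟨ cong (_* second) (binom-minus-vanish n (2 * k) k n<2k+k) ⟩
  0                                                         ≡⟨ cong (_* shiftedAt (n ∸ 2 * k) (k C_) j)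
                                                                     (C-minus-vanish n (2 * k) k n<2k+k (positive-of-< 2 k (≰⇒> 2k≰n))) ⟨
  ((n ∸ 2 * k) C k) * shiftedAt (n ∸ 2 * k) (k C_) j         ∎
  where
  open ≡-Reasoning
  n : ℕ
  n = i + j
  second : ℕ
  second = binom (+ k) (+ i -ℤ + k)
  n<2k+k : n < 2 * k + k
  n<2k+k = <-≤-trans (≰⇒> 2k≰n) (m≤m+n (2 * k) k)

calI-closed : ∀ n → calI n ≈P ΣP< (λ k → const ((n ∸ 2 * k) C k) ⊗ (X ^P (n ∸ 2 * k)) ⊗ (1+X ^P k)) (n / 3 + 1)
calI-closed = generating-≈ D″ R coeff-R coeff-R-above
  where
  R : ℕ → Poly
  R n = ΣP< (λ k → const ((n ∸ 2 * k) C k) ⊗ (X ^P (n ∸ 2 * k)) ⊗ (1+X ^P k)) (n / 3 + 1)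
  term : ℕ → ℕ → ℕ → ℕ
  term n j k = ((n ∸ 2 * k) C k) * shiftedAt (n ∸ 2 * k) (k C_) j
  coeff-R : ∀ i j → coeff (R (i + j)) j ≡ D″ i j
  coeff-R i j = begin
    coeff (R n) j                  ≡⟨ coeff-ΣP<-terms (λ k → (n ∸ 2 * k) C k) (λ k → n ∸ 2 * k) (λ k → k) (n / 3 + 1) j ⟩
    Σ< (term n j) (n / 3 + 1)      ≡⟨ Σ<-truncate (+-monoˡ-≤ 1 (m/n≤m n 3)) beyond ⟨
    Σ< (term n j) (n + 1)          ≡⟨ Σ<-cong (n + 1) (λ k _ → D″-summand-coeff i j k) ⟨
    Σ< (λ k → binom (+ i +ℤ + j -ℤ + 2 *ℤ + k) (+ k) * binom (+ k) (+ i -ℤ + k)) (n + 1)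
                                   ≡⟨ D″-closed i j ⟨
    D″ i j                         ∎
    where
    open ≡-Reasoning
    n : ℕ
    n = i + j
    beyond : ∀ k → n / 3 + 1 ≤ k → k < n + 1 → term n j k ≡ 0
    beyond k n/3+1≤k _ = cong (_* shiftedAt (n ∸ 2 * k) (k C_) j) (C-minus-vanish n (2 * k) k n<2k+k (positive-of-< 3 k n<3k))
      where
      n<3k : n < 3 * k
      n<3k = n/d<k⇒n<d*k n 3 k (m+1≤n⇒m<n n/3+1≤k)
      n<2k+k : n < 2 * k + k
      n<2k+k = subst (n <_) (three k) n<3k
        where
        three : ∀ k → 3 * k ≡ 2 * k + k
        three = solve-∀
  coeff-R-above : ∀ n j → n < j → coeff (R n) j ≡ 0
  coeff-R-above n j n<j = coeff-ΣP<-terms-beyond (λ k → (n ∸ 2 * k) C k) (λ k → n ∸ 2 * k) (λ k → k) (n / 3 + 1) j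
    (λ k k<n/3+1 → ≤-<-trans (degree k (≤-trans (m<n+1⇒m≤n k<n/3+1) (m/n≤m n 3))) n<j)
    where
    degree : ∀ k → k ≤ n → n ∸ 2 * k + k ≤ n
    degree k k≤n = ≤-trans (+-monoˡ-≤ k (∸-monoʳ-≤ n (m≤m+n k (k + 0)))) (≤-reflexive (m∸n+n≡m k≤n))

proposition4p1 : ∀ (a b n : ℕ) →
      (calD n ≈P ΣP< (λ k → const ((n ∸ k) C k) ⊗ (X ^P k) ⊗ (1+X ^P (n ∸ 2 * k))) (n / 2 + 1))
    × (D a b ≡ Σ< (λ k → binom (+ a +ℤ + b -ℤ + k) (+ k) * binom (+ a +ℤ + b -ℤ + 2 *ℤ + k) (+ b -ℤ + k)) (a + b + 1))
    × (calH n ≈P ΣP< (λ k → const ((n ∸ k) C k) ⊗ (X ^P k) ⊗ (1+X ^P (n ∸ k))) (n / 2 + 1))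
    × (D′ a b ≡ Σ< (λ k → binom (+ k) (+ a +ℤ + b -ℤ + k) * binom (+ k) (+ a)) (a + b + 1))
    × (calI n ≈P ΣP< (λ k → const ((n ∸ 2 * k) C k) ⊗ (X ^P (n ∸ 2 * k)) ⊗ (1+X ^P k)) (n / 3 + 1))
    × (D″ a b ≡ Σ< (λ k → binom (+ a +ℤ + b -ℤ + 2 *ℤ + k) (+ k) * binom (+ k) (+ a -ℤ + k)) (a + b + 1))
proposition4p1 a b n = calD-closed n , D-closed a b , calH-closed n , D′-closed a b , calI-closed n , D″-closed a b
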